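{- Let $n=p_1p_2\cdots p_k$, where $p_1<p_2<\cdots<p_k$ are distinct primes. Then the hyper-Wiener index of the essential ideal graph $\mathcal{E}_{\mathbb{Z}_n}$ is $$WW(\mathcal{E}_{\mathbb{Z}_n})=\frac12\sum_{t=1}^{k-1}\binom{k}{t}\big[3\cdot2^{k}-2\cdot2^{k-t}+3\cdot2^t-13\big].$$
   Context: $\mathbb{Z}_n$ is the ring of integers modulo $n$. An ideal $I$ of a commutative ring $R$ is essential if $I\cap J\neq\{0\}$ for every nonzero ideal $J$ of $R$. The essential ideal graph $\mathcal{E}_{\mathbb{Z}_n}$ is the simple graph whose vertex set is the set of all nonzero proper ideals of $\mathbb{Z}_n$, two distinct vertices $I,K$ being adjacent if and only if $I+K$ is an essential ideal of $\mathbb{Z}_n$. For a connected graph $G$ with distance $d$, the Wiener index is $W(G)=\sum_{\{u,v\}} d(u,v)$ and the hyper-Wiener index is $WW(G)=\frac12 W(G)+\frac12\sum_{\{u,v\}} d(u,v)^2$, both sums over unordered pairs of distinct vertices. -}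

module Defs where

open import Data.Bool using (Bool; true; false; _∧_; _∨_; not; if_then_else_)
open import Data.Nat using (ℕ; zero; suc; _+_; _*_; _∸_; _^_; _≡ᵇ_)
open import Data.Nat.DivMod using (_mod_)
open import Data.Nat.Combinatorics using (_C_)
open import Data.Fin using (Fin; toℕ)
open import Data.Vec using (Vec; []; _∷_; lookup; tabulate; zipWith)
open import Data.List using (List; []; _∷_; _++_; map; filterᵇ; allFin; length; upTo; drop; foldr)
open import Data.Bool.ListAction using (all; any)
open import Data.Nat.ListAction using (sum)
open import Data.Integer as ℤ using (ℤ; +_)
open import Data.Rational using (ℚ; _/_)
open import Relation.Binary.PropositionalEquality using (_≡_)

addₙ : ∀ {n} → Fin n → Fin n → Fin n
addₙ {suc m} a b = (toℕ a + toℕ b) mod suc m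

mulₙ : ∀ {n} → Fin n → Fin n → Fin n
mulₙ {suc m} a b = (toℕ a * toℕ b) mod suc m

negₙ : ∀ {n} → Fin n → Fin n
negₙ {suc m} a = (suc m ∸ toℕ a) mod suc m

isZeroₙ : ∀ {n} → Fin n → Bool
isZeroₙ a = toℕ a ≡ᵇ 0

_==ₙ_ : ∀ {n} → Fin n → Fin n → Bool
a ==ₙ b = toℕ a ≡ᵇ toℕ b

SubsetZ : ℕ → Set
SubsetZ n = Vec Bool n

_∈ᵇ_ : ∀ {n} → Fin n → SubsetZ n → Bool
x ∈ᵇ S = lookup S x

∀ₙ : ∀ {n} → (Fin n → Bool) → Bool
∀ₙ {n} P = all P (allFin n)

∃ₙ : ∀ {n} → (Fin n → Bool) → Bool
∃ₙ {n} P = any P (allFin n)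

_⇒ᵇ_ : Bool → Bool → Bool
a ⇒ᵇ b = not a ∨ b

allSubsets : ∀ n → List (SubsetZ n)
allSubsets zero = [] ∷ []
allSubsets (suc n) = map (true ∷_) (allSubsets n) ++ map (false ∷_) (allSubsets n)

_==ˢ_ : ∀ {n} → SubsetZ n → SubsetZ n → Bool
S ==ˢ T = ∀ₙ (λ x → (x ∈ᵇ S) ⇒ᵇ (x ∈ᵇ T) ∧ ((x ∈ᵇ T) ⇒ᵇ (x ∈ᵇ S)))

isIdeal : ∀ {n} → SubsetZ n → Bool
isIdeal I =
  ∃ₙ (λ z → isZeroₙ z ∧ (z ∈ᵇ I))
  ∧ ∀ₙ (λ a → ∀ₙ (λ b → ((a ∈ᵇ I) ∧ (b ∈ᵇ I)) ⇒ᵇ (addₙ a b ∈ᵇ I)))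
  ∧ ∀ₙ (λ a → (a ∈ᵇ I) ⇒ᵇ (negₙ a ∈ᵇ I))
  ∧ ∀ₙ (λ r → ∀ₙ (λ a → (a ∈ᵇ I) ⇒ᵇ (mulₙ r a ∈ᵇ I)))

isNonzero : ∀ {n} → SubsetZ n → Bool
isNonzero I = ∃ₙ (λ x → not (isZeroₙ x) ∧ (x ∈ᵇ I))

isProper : ∀ {n} → SubsetZ n → Bool
isProper I = ∃ₙ (λ x → not (x ∈ᵇ I))

ideals : ∀ n → List (SubsetZ n)
ideals n = filterᵇ isIdeal (allSubsets n)

_+ᴵ_ : ∀ {n} → SubsetZ n → SubsetZ n → SubsetZ n
I +ᴵ K = tabulate (λ x → ∃ₙ (λ a → ∃ₙ (λ b → (a ∈ᵇ I) ∧ (b ∈ᵇ K) ∧ (addₙ a b ==ₙ x))))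

_∩ᴵ_ : ∀ {n} → SubsetZ n → SubsetZ n → SubsetZ n
I ∩ᴵ J = zipWith _∧_ I J

isEssential : ∀ {n} → SubsetZ n → Bool
isEssential {n} I = all (λ J → isNonzero J ⇒ᵇ isNonzero (I ∩ᴵ J)) (ideals n)

-- Finite simple graphs given by a duplicate-free vertex list and a
-- Boolean adjacency relation; distances, Wiener and hyper-Wiener index

record FinGraph : Set₁ where
  field
    Vtx  : Set
    V    : List Vtx
    _≟ᵥ_ : Vtx → Vtx → Bool
    adj  : Vtx → Vtx → Bool

module _ (G : FinGraph) where
  open FinGraph G

  reach : ℕ → Vtx → Vtx → Bool
  reach zero u v = u ≟ᵥ v
  reach (suc m) u v = reach m u v ∨ any (λ w → reach m u w ∧ adj w v) V

  Connected : Set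
  Connected = all (λ u → all (λ v → reach (length V) u v) V) V ≡ true

  private
    least : ℕ → ℕ → (ℕ → Bool) → ℕ
    least zero s P = s
    least (suc f) s P = if P s then s else least f (suc s) P

  dist : Vtx → Vtx → ℕ
  dist u v = least (length V) 0 (λ m → reach m u v)

  pairSum : (Vtx → Vtx → ℕ) → ℕ
  pairSum f = go V
    where
    go : List Vtx → ℕ
    go [] = 0
    go (x ∷ xs) = sum (map (f x) xs) + go xs

  wiener : ℕ
  wiener = pairSum dist

  hyperWiener : ℚ
  hyperWiener = (+ (wiener + pairSum (λ u v → dist u v * dist u v))) / 2

essentialIdealGraph : ℕ → FinGraph
essentialIdealGraph n = record
  { Vtx  = SubsetZ n
  ; V    = filterᵇ (λ I → isIdeal I ∧ isNonzero I ∧ isProper I) (allSubsets n)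
  ; _≟ᵥ_ = _==ˢ_
  ; adj  = λ I K → not (I ==ˢ K) ∧ isEssential (I +ᴵ K)
  }

sumℤ : List ℤ → ℤ
sumℤ = foldr ℤ._+_ (+ 0)

wwFormula : ℕ → ℚ
wwFormula k = sumℤ (map term (drop 1 (upTo k))) / 2
  where
  term : ℕ → ℤ
  term t = (+ (k C t)) ℤ.* ((((+ (3 * 2 ^ k)) ℤ.- (+ (2 * 2 ^ (k ∸ t)))) ℤ.+ (+ (3 * 2 ^ t))) ℤ.- (+ 13))

productℕ : List ℕ → ℕ
productℕ = foldr _*_ 1

-- For N = p₁ ⋯ p_k squarefree, every ideal of ℤ_N is generated by ∏_{i ∈ S} p_i for a unique
-- S ⊆ {1, …, k}; it is nonzero and proper exactly when S is a proper nonempty subset, and the sum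
-- of the ideals of S and U is essential exactly when S ∩ U = ∅ (then it is all of ℤ_N, by
-- Bézout).  So the essential ideal graph is the graph on proper nonempty subsets in which disjoint
-- subsets are adjacent.  Its distances are 1 when S ∩ U = ∅ and otherwise 2 (through ∁ (S ∪ U))
-- or, when S ∪ U = ⊤, 3 (through ∁ S and ∁ U).  Counting, for fixed S with |S| = t, the subsets
-- disjoint from S (2^(k-t)) and those covering the rest (2^t) gives
-- ∑_U (d + d²) = 6·2^k + 6·2^t - 4·2^(k-t) - 26, and grouping the S by size gives the binomial
-- sum, since WW = ¼ ∑_{S,U} (d + d²).

module Submission where

import Algebra.Lattice.Properties.BooleanAlgebra as BooleanAlgebraProperties
open import Data.Bool as Bool using (Bool; true; false; T; T?; not; _∧_; if_then_else_)
open import Data.Bool.Properties using (T-≡; T-∧; T-∨; ∧-zeroʳ)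
open import Data.Empty using (⊥-elim)
open import Data.Fin using (Fin; zero; suc; toℕ; _<_)
open import Data.Fin.Properties using (toℕ-injective; toℕ-fromℕ<; toℕ<n; <-cmp)
open import Data.Fin.Subset using (Subset; ⊥; ⊤; ∁; _∩_; _∪_; ∣_∣)
open import Data.Fin.Subset.Properties
  using (∩-abs-∪; ∩-assoc; ∩-zeroˡ; ∩-comm; ∪-comm; ∩-idem; ∪-idem; ∩-zeroʳ; ∩-identityʳ; ∪-identityʳ; ∪-zeroʳ
        ; ∩-inverseʳ; ∩-inverseˡ; ∪-inverseʳ; ∩-distribˡ-∪; ∪-distribˡ-∩; ∪-∩-booleanAlgebra; ∣⊥∣≡0; ∣⊤∣≡n; ∣∁p∣≡n∸∣p∣)
open import Data.List using (List; []; _∷_; _++_; _∷ʳ_; map; foldr; filter; filterᵇ; allFin; length; upTo; drop)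
open import Data.List.Membership.Propositional using (_∈_; find; lose)
open import Data.List.Membership.Propositional.Properties
  using (∈-allFin; ∈-∃++; ∈-++⁺ˡ; ∈-++⁺ʳ; ∈-++⁻; ∈-map⁺; ∈-map⁻; ∈-filter⁺; ∈-filter⁻)
open import Data.List.Membership.Propositional.Properties.WithK using (unique∧set⇒bag)
open import Data.List.Properties using (map-++; map-∘; length-map; map-applyUpTo; applyUpTo-∷ʳ)
open import Data.List.Relation.Binary.BagAndSetEquality using (∼bag⇒↭)
open import Data.List.Relation.Binary.Permutation.Propositional using (_↭_; ↭-sym)
open import Data.List.Relation.Binary.Permutation.Propositional.Properties as ↭ using (∈-resp-↭; Any-resp-↭; ↭-length)
open import Data.List.Relation.Unary.All as All using (All; []; _∷_)
open import Data.List.Relation.Unary.All.Properties using (all⁺; all⁻)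
open import Data.List.Relation.Unary.AllPairs using ([]; _∷_)
open import Data.List.Relation.Unary.Any using (Any; here; there)
open import Data.List.Relation.Unary.Any.Properties as Any using (any⁺; any⁻)
open import Data.List.Relation.Unary.Unique.Propositional using (Unique)
import Data.List.Relation.Unary.Unique.Propositional.Properties as Unique
open import Data.Nat
  using (ℕ; zero; suc; pred; _+_; _*_; _∸_; _^_; _%_; _≤_; _>_; _≤?_; _≟_; z≤n; s≤s; NonZero; nonTrivial⇒≢1; nonTrivial⇒n>1)
open import Data.Nat.Combinatorics using (_C_; nCn≡1; nCk+nC[k+1]≡[n+1]C[k+1])
open import Data.Nat.Coprimality using (Coprime; coprime-divisor; coprime-Bézout)
open import Data.Nat.DivMod using (_mod_; m%n<n; m<n⇒m%n≡m; %-distribˡ-+; %-distribˡ-*; [m+kn]%n≡m%n; n%n≡0)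
open import Data.Nat.Divisibility
  using (_∣_; _∣?_; divides; ∣-refl; ∣-trans; ∣1⇒≡1; 1∣_; _∣0; *-monoˡ-∣; *-cancelʳ-∣; ∣m⇒∣m*n; ∣n⇒∣m*n; ∣m+n∣m⇒∣n; ∣m∣n⇒∣m+n
        ; quotient; quotient≢0; m∣n⇒n≡m*quotient; ∣⇒≤; %-presˡ-∣; ∣n∣m%n⇒∣m; n∣m⇒m%n≡0; m%n≡0⇒n∣m)
open import Data.Nat.GCD using (gcd; gcd[m,n]∣m; gcd[m,n]∣n; gcd-GCD; module Bézout)
open import Data.Nat.ListAction using (sum; product)
open import Data.Nat.ListAction.Properties using (sum-++; sum-↭; ∈⇒∣product)
open import Data.Nat.Primality using (Prime; euclidsLemma; prime⇒irreducible; prime⇒nonZero; prime⇒nonTrivial; productOfPrimes≢0)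
open import Data.Nat.Properties
  using (+-assoc; +-comm; +-suc; +-identityʳ; +-cancelˡ-≡; *-comm; *-zeroʳ; *-identityˡ; *-identityʳ; *-distribˡ-+; *-distribʳ-+
        ; ≤-refl; ≤-reflexive; ≤-trans; ≤-antisym; m≤n⇒m≤1+n; m≤n+m; n≤0⇒n≡0; ≰⇒>; ≤∧≢⇒<; <⇒≤; <⇒≢; <-≤-trans; <-irrefl; m<m*n
        ; m∸n+n≡m; m+n∸n≡m; m+[n∸m]≡n; ≡ᵇ⇒≡; ≡⇒≡ᵇ; suc-pred; +-commutativeSemigroup; module ≤-Reasoning)
open import Algebra.Properties.CommutativeSemigroup +-commutativeSemigroup using (interchange)
open import Data.Nat.Tactic.RingSolver using (solve-∀)
open import Data.Product using (∃; _×_; _,_; proj₁; proj₂)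
open import Data.Rational using (_/_)
open import Data.Sum using (inj₁; inj₂)
open import Data.Vec using (Vec; []; _∷_; lookup; tabulate)
open import Data.Vec.Properties
  using (≡-dec; ∷-injective; lookup-replicate; lookup-map; lookup-zipWith; lookup∘tabulate; tabulate∘lookup; tabulate-cong)
open import Function using (_∘_; _⇔_; mk⇔; Equivalence)
open Equivalence using (to; from)
import Function.Properties.Equivalence as ⇔
open import Relation.Binary.Definitions using (DecidableEquality; tri<; tri≈; tri>)
open import Relation.Binary.PropositionalEquality using (_≡_; _≢_; refl; sym; trans; cong; cong₂; subst; module ≡-Reasoning)
open import Relation.Nullary using (¬_; Dec; yes; no; does; ¬?; _×-dec_)
open import Relation.Nullary.Decidable using (dec-true; dec-false; decidable-stable; does-⇔)
open import Defs

private
  variable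
    A B : Set
    k n g p q x y : ℕ
    ps xs : List ℕ

∑ : List A → (A → ℕ) → ℕ
∑ xs f = sum (map f xs)

syntax ∑ xs (λ x → e) = ∑[ x ∈ xs ] e

∑-++ : ∀ (f : A → ℕ) xs ys → ∑ (xs ++ ys) f ≡ ∑ xs f + ∑ ys f
∑-++ f xs ys = trans (cong sum (map-++ f xs ys)) (sum-++ (map f xs) (map f ys))

∑-map : ∀ (f : B → ℕ) (g : A → B) xs → ∑ (map g xs) f ≡ ∑ xs (f ∘ g)
∑-map f g xs = cong sum (sym (map-∘ xs))

∑-cong : ∀ {f g : A → ℕ} xs → (∀ {x} → x ∈ xs → f x ≡ g x) → ∑ xs f ≡ ∑ xs g
∑-cong []       f≗g = refl
∑-cong (x ∷ xs) f≗g = cong₂ _+_ (f≗g (here refl)) (∑-cong xs (f≗g ∘ there))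

∑-+ : ∀ (f g : A → ℕ) xs → ∑[ x ∈ xs ] (f x + g x) ≡ ∑ xs f + ∑ xs g
∑-+ f g []       = refl
∑-+ f g (x ∷ xs) = begin
  f x + g x + ∑[ y ∈ xs ] (f y + g y)   ≡⟨ cong (f x + g x +_) (∑-+ f g xs) ⟩
  f x + g x + (∑ xs f + ∑ xs g)         ≡⟨ interchange (f x) (g x) _ _ ⟩
  f x + ∑ xs f + (g x + ∑ xs g)         ∎
  where open ≡-Reasoning

∑-* : ∀ c (f : A → ℕ) xs → ∑[ x ∈ xs ] (c * f x) ≡ c * ∑ xs f
∑-* c f []       = sym (*-zeroʳ c)
∑-* c f (x ∷ xs) = trans (cong (c * f x +_) (∑-* c f xs)) (sym (*-distribˡ-+ c (f x) _))

∑-+-* : ∀ c (f g : A → ℕ) xs → ∑[ x ∈ xs ] (f x + c * g x) ≡ ∑ xs f + c * ∑ xs g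
∑-+-* c f g xs = trans (∑-+ f (λ x → c * g x) xs) (cong (∑ xs f +_) (∑-* c g xs))

∑-zero : ∀ (xs : List A) → ∑[ x ∈ xs ] 0 ≡ 0
∑-zero []       = refl
∑-zero (x ∷ xs) = ∑-zero xs

∑-↭ : ∀ (f : A → ℕ) {xs ys} → xs ↭ ys → ∑ xs f ≡ ∑ ys f
∑-↭ f = sum-↭ ∘ ↭.map⁺ f

unique-⇔⇒↭ : ∀ {xs ys : List A} → Unique xs → Unique ys → (∀ {z} → z ∈ xs ⇔ z ∈ ys) → xs ↭ ys
unique-⇔⇒↭ xs! ys! xs⇔ys = ∼bag⇒↭ (unique∧set⇒bag xs! ys! xs⇔ys)

∈-++-∷⁻ : ∀ {x y : A} xs ys → x ∈ xs ++ y ∷ ys → x ≢ y → x ∈ xs ++ ys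
∈-++-∷⁻ {x} {y} xs ys x∈ x≢y with ∈-++⁻ xs x∈
... | inj₁ x∈xs         = ∈-++⁺ˡ x∈xs
... | inj₂ (here x≡y)   = ⊥-elim (x≢y x≡y)
... | inj₂ (there x∈ys) = ∈-++⁺ʳ xs x∈ys

unique⊆⇒length≤ : ∀ {xs ys : List A} → Unique xs → (∀ {x} → x ∈ xs → x ∈ ys) → length xs ≤ length ys
unique⊆⇒length≤ {xs = []}     _            _      = z≤n
unique⊆⇒length≤ {xs = x ∷ xs} (x∉xs ∷ xs!) xs⊆ys with ∈-∃++ (xs⊆ys (here refl))
... | ys₁ , ys₂ , refl = subst (suc (length xs) ≤_) (sym (↭-length (↭.shift x ys₁ ys₂)))
                               (s≤s (unique⊆⇒length≤ xs! xs⊆ys₁++ys₂))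
  where
  xs⊆ys₁++ys₂ : ∀ {z} → z ∈ xs → z ∈ ys₁ ++ ys₂
  xs⊆ys₁++ys₂ z∈xs = ∈-++-∷⁻ ys₁ ys₂ (xs⊆ys (there z∈xs)) (λ { refl → All.lookup x∉xs z∈xs refl })

T-⇒ᵇ : ∀ {a b} → T (a ⇒ᵇ b) ⇔ (T a → T b)
T-⇒ᵇ {true}  = mk⇔ (λ b _ → b) (λ f → f _)
T-⇒ᵇ {false} = mk⇔ (λ _ ()) (λ _ → _)

T-not : ∀ {b} → T (not b) ⇔ (¬ T b)
T-not {true}  = mk⇔ (λ ()) (λ ¬T → ¬T _)
T-not {false} = mk⇔ (λ _ ()) (λ _ → _)

T-does : ∀ {P : Set} (P? : Dec P) → T (does P?) ⇔ P
T-does (yes P) = mk⇔ (λ _ → P) (λ _ → _)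
T-does (no ¬P) = mk⇔ (λ ()) ¬P

T-injective : ∀ {a b} → (T a ⇔ T b) → a ≡ b
T-injective {a} {b} a⇔b = does-⇔ a⇔b (T? a) (T? b)

∈ᵇ-ext : ∀ {n} {I K : Vec Bool n} → (∀ x → T (x ∈ᵇ I) ⇔ T (x ∈ᵇ K)) → I ≡ K
∈ᵇ-ext {I = I} {K} I⇔K = begin
  I                    ≡⟨ tabulate∘lookup I ⟨
  tabulate (lookup I)  ≡⟨ tabulate-cong (λ x → T-injective (I⇔K x)) ⟩
  tabulate (lookup K)  ≡⟨ tabulate∘lookup K ⟩
  K                    ∎
  where open ≡-Reasoning

module _ {n} {P : Fin n → Bool} where

  T-∀ₙ : T (∀ₙ P) ⇔ (∀ x → T (P x))
  T-∀ₙ = mk⇔ (λ ∀P x → All.lookup (all⁺ P (allFin n) ∀P) (∈-allFin x))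
             (λ ∀P → all⁻ P {allFin n} (All.tabulate (λ {x} _ → ∀P x)))

  T-∃ₙ : T (∃ₙ P) ⇔ ∃ λ x → T (P x)
  T-∃ₙ = mk⇔ (λ ∃P → let x , _ , Px = find (any⁻ P (allFin n) ∃P) in x , Px)
             (λ (x , Px) → any⁺ P (lose (∈-allFin x) Px))

-- Ideals of ℤ_N

foldr-gcd-∣ : ∀ n xs → foldr gcd n xs ∣ n
foldr-gcd-∣ n []       = ∣-refl
foldr-gcd-∣ n (x ∷ xs) = ∣-trans (gcd[m,n]∣n x _) (foldr-gcd-∣ n xs)

foldr-gcd-∣-∈ : ∀ n {xs} → x ∈ xs → foldr gcd n xs ∣ x
foldr-gcd-∣-∈ n {y ∷ xs} (here refl) = gcd[m,n]∣m y _
foldr-gcd-∣-∈ n {y ∷ xs} (there x∈xs) = ∣-trans (gcd[m,n]∣n y _) (foldr-gcd-∣-∈ n x∈xs)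

foldr-gcd-closed : ∀ {P : ℕ → Set} → (∀ {a b} → P a → P b → P (gcd a b)) → P n → All P xs → P (foldr gcd n xs)
foldr-gcd-closed gcd-closed Pn []         = Pn
foldr-gcd-closed gcd-closed Pn (Px ∷ Pxs) = gcd-closed Px (foldr-gcd-closed gcd-closed Pn Pxs)

+≡⇒∸≡ : ∀ {a b c} → a + b ≡ c → c ∸ b ≡ a
+≡⇒∸≡ {a} {b} refl = m+n∸n≡m a b

module _ {n} {I : SubsetZ n} where

  isIdeal⁻ : T (isIdeal I) → (∃ λ z → toℕ z ≡ 0 × T (z ∈ᵇ I))
                             × (∀ a b → T (a ∈ᵇ I) → T (b ∈ᵇ I) → T (addₙ a b ∈ᵇ I))
                             × (∀ r a → T (a ∈ᵇ I) → T (mulₙ r a ∈ᵇ I))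
  isIdeal⁻ isIdeal-I with to T-∧ isIdeal-I
  ... | ∃0 , rest with to T-∧ rest
  ... | add-closed , rest′ with to T-∧ rest′
  ... | _ , mul-closed = has-0 , add , mul
    where
    has-0 : ∃ λ z → toℕ z ≡ 0 × T (z ∈ᵇ I)
    has-0 with to T-∃ₙ ∃0
    ... | z , z≡0∧z∈I with to T-∧ z≡0∧z∈I
    ...   | z≡0 , z∈I = z , ≡ᵇ⇒≡ (toℕ z) 0 z≡0 , z∈I
    add : ∀ a b → T (a ∈ᵇ I) → T (b ∈ᵇ I) → T (addₙ a b ∈ᵇ I)
    add a b a∈ b∈ = to T-⇒ᵇ (to T-∀ₙ (to T-∀ₙ add-closed a) b) (from T-∧ (a∈ , b∈))
    mul : ∀ r a → T (a ∈ᵇ I) → T (mulₙ r a ∈ᵇ I)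
    mul r a a∈ = to T-⇒ᵇ (to T-∀ₙ (to T-∀ₙ mul-closed r) a) a∈

  isIdeal⁺ : (∃ λ z → toℕ z ≡ 0 × T (z ∈ᵇ I))
           → (∀ a b → T (a ∈ᵇ I) → T (b ∈ᵇ I) → T (addₙ a b ∈ᵇ I))
           → (∀ a → T (a ∈ᵇ I) → T (negₙ a ∈ᵇ I))
           → (∀ r a → T (a ∈ᵇ I) → T (mulₙ r a ∈ᵇ I))
           → T (isIdeal I)
  isIdeal⁺ (z , z≡0 , z∈I) add neg mul = from T-∧
    ( from T-∃ₙ (z , from T-∧ (≡⇒≡ᵇ (toℕ z) 0 z≡0 , z∈I))
    , from T-∧
      ( from T-∀ₙ (λ a → from T-∀ₙ (λ b → from T-⇒ᵇ (λ a∧b∈I →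
          let a∈I , b∈I = to T-∧ a∧b∈I in add a b a∈I b∈I)))
      , from T-∧
        ( from T-∀ₙ (λ a → from T-⇒ᵇ (neg a))
        , from T-∀ₙ (λ r → from T-∀ₙ (λ a → from T-⇒ᵇ (mul r a))))))

  T-isNonzero : T (isNonzero I) ⇔ ∃ λ x → toℕ x ≢ 0 × T (x ∈ᵇ I)
  T-isNonzero = mk⇔
    (λ nonzero → let x , x≢0∧x∈I = to T-∃ₙ nonzero
                     x≢0 , x∈I = to T-∧ x≢0∧x∈I
                 in x , to T-not x≢0 ∘ ≡⇒≡ᵇ (toℕ x) 0 , x∈I)
    (λ (x , x≢0 , x∈I) → from T-∃ₙ (x , from T-∧ (from T-not (x≢0 ∘ ≡ᵇ⇒≡ (toℕ x) 0) , x∈I)))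

  T-isProper : T (isProper I) ⇔ ∃ λ x → ¬ T (x ∈ᵇ I)
  T-isProper = mk⇔ (λ proper → let x , x∉I = to T-∃ₙ proper in x , to T-not x∉I)
                   (λ (x , x∉I) → from T-∃ₙ (x , from T-not x∉I))

  T-isEssential : T (isEssential I) ⇔ (∀ {J} → J ∈ ideals n → T (isNonzero J) → T (isNonzero (I ∩ᴵ J)))
  T-isEssential = mk⇔ (λ essential {J} J∈ → to T-⇒ᵇ (All.lookup (all⁺ _ (ideals n) essential) J∈))
                      (λ meets → all⁻ _ (All.tabulate (λ {J} J∈ → from T-⇒ᵇ (meets J∈))))

  T-==ˢ : ∀ {K} → T (I ==ˢ K) ⇔ I ≡ K
  T-==ˢ = mk⇔ (λ I==K → ∈ᵇ-ext λ x → let I⇒K , K⇒I = to T-∧ (to T-∀ₙ I==K x)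
                                       in mk⇔ (to T-⇒ᵇ I⇒K) (to T-⇒ᵇ K⇒I))
              (λ { refl → from (T-∀ₙ {n}) λ x → ⇔ᵇ-refl (x ∈ᵇ I) })
    where
    ⇔ᵇ-refl : ∀ b → T ((b ⇒ᵇ b) ∧ (b ⇒ᵇ b))
    ⇔ᵇ-refl true  = _
    ⇔ᵇ-refl false = _

  T-∩ᴵ : ∀ {J} x → T (x ∈ᵇ (I ∩ᴵ J)) ⇔ (T (x ∈ᵇ I) × T (x ∈ᵇ J))
  T-∩ᴵ {J} x = subst (λ b → T b ⇔ (T (x ∈ᵇ I) × T (x ∈ᵇ J))) (sym (lookup-zipWith _∧_ x I J)) T-∧

  T-+ᴵ : ∀ {K} x → T (x ∈ᵇ (I +ᴵ K)) ⇔ ∃ λ a → ∃ λ b → T (a ∈ᵇ I) × T (b ∈ᵇ K) × toℕ (addₙ a b) ≡ toℕ x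
  T-+ᴵ {K} x = subst (λ b → T b ⇔ (∃ λ a → ∃ λ b → T (a ∈ᵇ I) × T (b ∈ᵇ K) × toℕ (addₙ a b) ≡ toℕ x))
                     (sym (lookup∘tabulate _ x)) (mk⇔ unpack pack)
    where
    unpack : T (∃ₙ (λ a → ∃ₙ (λ b → (a ∈ᵇ I) ∧ (b ∈ᵇ K) ∧ (addₙ a b ==ₙ x)))) →
             ∃ λ a → ∃ λ b → T (a ∈ᵇ I) × T (b ∈ᵇ K) × toℕ (addₙ a b) ≡ toℕ x
    unpack ∃a with to (T-∃ₙ {n}) ∃a
    ... | a , ∃b with to (T-∃ₙ {n}) ∃b
    ...   | b , a∈∧b∈∧a+b≡x with to T-∧ a∈∧b∈∧a+b≡x
    ...     | a∈I , b∈∧a+b≡x with to T-∧ b∈∧a+b≡x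
    ...       | b∈K , a+b≡x = a , b , a∈I , b∈K , ≡ᵇ⇒≡ (toℕ (addₙ a b)) (toℕ x) a+b≡x
    pack : (∃ λ a → ∃ λ b → T (a ∈ᵇ I) × T (b ∈ᵇ K) × toℕ (addₙ a b) ≡ toℕ x) →
           T (∃ₙ (λ a → ∃ₙ (λ b → (a ∈ᵇ I) ∧ (b ∈ᵇ K) ∧ (addₙ a b ==ₙ x))))
    pack (a , b , a∈I , b∈K , a+b≡x) = from (T-∃ₙ {n}) (a , from (T-∃ₙ {n}) (b ,
      from (T-∧ {a ∈ᵇ I}) (a∈I , from (T-∧ {b ∈ᵇ K}) (b∈K , ≡⇒≡ᵇ (toℕ (addₙ a b)) (toℕ x) a+b≡x))))

full⇒essential : ∀ {n} {I : SubsetZ n} → (∀ x → T (x ∈ᵇ I)) → T (isEssential I)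
full⇒essential {I = I} full = from (T-isEssential {I = I}) λ {J} _ J≢0 →
  let x , x≢0 , x∈J = to (T-isNonzero {I = J}) J≢0
  in from (T-isNonzero {I = I ∩ᴵ J}) (x , x≢0 , from (T-∩ᴵ {I = I} {J} x) (full x , x∈J))

module Residues (m : ℕ) where

  N : ℕ
  N = suc m

  infix 4 _∈ᶻ_

  -- A record rather than a function, so that x and I can be inferred from x ∈ᶻ I.
  record _∈ᶻ_ (x : ℕ) (I : SubsetZ N) : Set where
    constructor residue∈
    field
      residue∈⁻ : T ((x mod N) ∈ᵇ I)

  toℕ-mod : ∀ x → toℕ (x mod N) ≡ x % N
  toℕ-mod x = toℕ-fromℕ< (m%n<n x N)

  mod-toℕ : ∀ (a : Fin N) → toℕ a mod N ≡ a
  mod-toℕ a = toℕ-injective (trans (toℕ-mod (toℕ a)) (m<n⇒m%n≡m (toℕ<n a)))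

  mod-cong : ∀ x y → x % N ≡ y % N → x mod N ≡ y mod N
  mod-cong x y eq = toℕ-injective (trans (toℕ-mod x) (trans eq (sym (toℕ-mod y))))

  ∈ᶻ⇔ : ∀ {I} → x ∈ᶻ I ⇔ T ((x mod N) ∈ᵇ I)
  ∈ᶻ⇔ = mk⇔ _∈ᶻ_.residue∈⁻ residue∈

  ∈ᶻ-resp : ∀ {I} → x % N ≡ y % N → x ∈ᶻ I → y ∈ᶻ I
  ∈ᶻ-resp {x} {y} {I} eq (residue∈ x∈) = residue∈ (subst (λ a → T (a ∈ᵇ I)) (mod-cong x y eq) x∈)

  ∈⇔∈ᶻ : ∀ {I} (a : Fin N) → T (a ∈ᵇ I) ⇔ toℕ a ∈ᶻ I
  ∈⇔∈ᶻ {I} a = mk⇔ (residue∈ ∘ subst (λ b → T (b ∈ᵇ I)) (sym (mod-toℕ a)))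
                    (subst (λ b → T (b ∈ᵇ I)) (mod-toℕ a) ∘ _∈ᶻ_.residue∈⁻)

  addₙ-mod : ∀ x y → addₙ (x mod N) (y mod N) ≡ (x + y) mod N
  addₙ-mod x y = mod-cong (toℕ (x mod N) + toℕ (y mod N)) (x + y) (begin
    (toℕ (x mod N) + toℕ (y mod N)) % N  ≡⟨ cong₂ (λ a b → (a + b) % N) (toℕ-mod x) (toℕ-mod y) ⟩
    (x % N + y % N) % N                  ≡⟨ %-distribˡ-+ x y N ⟨
    (x + y) % N                          ∎)
    where open ≡-Reasoning

  mulₙ-mod : ∀ x y → mulₙ (x mod N) (y mod N) ≡ (x * y) mod N
  mulₙ-mod x y = mod-cong (toℕ (x mod N) * toℕ (y mod N)) (x * y) (begin
    (toℕ (x mod N) * toℕ (y mod N)) % N  ≡⟨ cong₂ (λ a b → (a * b) % N) (toℕ-mod x) (toℕ-mod y) ⟩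
    (x % N * (y % N)) % N                ≡⟨ %-distribˡ-* x y N ⟨
    (x * y) % N                          ∎)
    where open ≡-Reasoning

  record IsIdeal (I : SubsetZ N) : Set where
    field
      0∈        : 0 ∈ᶻ I
      +-closed  : x ∈ᶻ I → y ∈ᶻ I → x + y ∈ᶻ I
      *-closed  : ∀ r {x} → x ∈ᶻ I → r * x ∈ᶻ I

    -- x ∸ y is congruent to x + (N - 1) y, so no additive inverses are needed.
    ∸-closed : x ∈ᶻ I → y ∈ᶻ I → y ≤ x → x ∸ y ∈ᶻ I
    ∸-closed {x} {y} x∈ y∈ y≤x = ∈ᶻ-resp x+my%N≡[x∸y]%N (+-closed x∈ (*-closed m y∈))
      where
      x+my%N≡[x∸y]%N : (x + m * y) % N ≡ (x ∸ y) % N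
      x+my%N≡[x∸y]%N = begin
        (x + m * y) % N               ≡⟨ cong (λ z → (z + m * y) % N) (m∸n+n≡m y≤x) ⟨
        (x ∸ y + y + m * y) % N       ≡⟨ cong (_% N) (+-assoc (x ∸ y) y (m * y)) ⟩
        (x ∸ y + (y + m * y)) % N     ≡⟨ cong (λ z → (x ∸ y + z) % N) (*-comm (suc m) y) ⟩
        (x ∸ y + y * N) % N           ≡⟨ [m+kn]%n≡m%n (x ∸ y) y N ⟩
        (x ∸ y) % N                   ∎
        where open ≡-Reasoning

    gcd-closed : x ∈ᶻ I → y ∈ᶻ I → gcd x y ∈ᶻ I
    gcd-closed {x} {y} x∈ y∈ with Bézout.identity (gcd-GCD x y)
    ... | Bézout.+- u v gcd+vy≡ux = subst (_∈ᶻ I) (+≡⇒∸≡ gcd+vy≡ux)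
            (∸-closed (*-closed u x∈) (*-closed v y∈) (subst (v * y ≤_) gcd+vy≡ux (m≤n+m (v * y) _)))
    ... | Bézout.-+ u v gcd+ux≡vy = subst (_∈ᶻ I) (+≡⇒∸≡ gcd+ux≡vy)
            (∸-closed (*-closed v y∈) (*-closed u x∈) (subst (u * x ≤_) gcd+ux≡vy (m≤n+m (u * x) _)))

  isIdeal⇒IsIdeal : ∀ {I} → T (isIdeal I) → IsIdeal I
  isIdeal⇒IsIdeal {I} isIdeal-I with isIdeal⁻ {I = I} isIdeal-I
  ... | (z , z≡0 , z∈I) , add-closed , mul-closed = record
    { 0∈       = subst (_∈ᶻ I) z≡0 (to (∈⇔∈ᶻ z) z∈I)
    ; +-closed = λ {x} {y} x∈ y∈ → from ∈ᶻ⇔ (subst (λ a → T (a ∈ᵇ I)) (addₙ-mod x y)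
                   (add-closed (x mod N) (y mod N) (to ∈ᶻ⇔ x∈) (to ∈ᶻ⇔ y∈)))
    ; *-closed = λ r {x} x∈ → from ∈ᶻ⇔ (subst (λ a → T (a ∈ᵇ I)) (mulₙ-mod r x)
                   (mul-closed (r mod N) (x mod N) (to ∈ᶻ⇔ x∈)))
    }

  generator : SubsetZ N → ℕ
  generator I = foldr gcd N (map toℕ (filterᵇ (_∈ᵇ I) (allFin N)))

  module _ (I : SubsetZ N) where

    private
      ∈-members : ∀ {a} → T (a ∈ᵇ I) → toℕ a ∈ map toℕ (filterᵇ (_∈ᵇ I) (allFin N))
      ∈-members a∈I = ∈-map⁺ toℕ (∈-filter⁺ (T? ∘ (_∈ᵇ I)) (∈-allFin _) a∈I)

    generator-∣N : generator I ∣ N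
    generator-∣N = foldr-gcd-∣ N (map toℕ (filterᵇ (_∈ᵇ I) (allFin N)))

    generator-∣ : ∀ {a} → T (a ∈ᵇ I) → generator I ∣ toℕ a
    generator-∣ a∈I = foldr-gcd-∣-∈ N (∈-members a∈I)

    generator-∈ : IsIdeal I → generator I ∈ᶻ I
    generator-∈ I-ideal = foldr-gcd-closed gcd-closed N∈ (All.tabulate members∈)
      where
      open IsIdeal I-ideal
      N∈ : N ∈ᶻ I
      N∈ = ∈ᶻ-resp (sym (n%n≡0 N)) 0∈
      members∈ : ∀ {x} → x ∈ map toℕ (filterᵇ (_∈ᵇ I) (allFin N)) → x ∈ᶻ I
      members∈ x∈ with ∈-map⁻ toℕ x∈
      ... | a , a∈ , refl = to (∈⇔∈ᶻ a) (proj₂ (∈-filter⁻ (T? ∘ (_∈ᵇ I)) a∈))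

    ∈⇔generator-∣ : IsIdeal I → ∀ a → T (a ∈ᵇ I) ⇔ generator I ∣ toℕ a
    ∈⇔generator-∣ I-ideal a = mk⇔ generator-∣ λ { (divides q a≡qg) →
      from (∈⇔∈ᶻ a) (subst (_∈ᶻ I) (sym a≡qg) (IsIdeal.*-closed I-ideal q (generator-∈ I-ideal))) }

  -- If a + b ≡ 1 then every x is x a + x b.
  +ᴵ-full : ∀ {I K a b} → IsIdeal I → IsIdeal K → a ∈ᶻ I → b ∈ᶻ K → (a + b) % N ≡ 1 % N →
            ∀ x → T (x ∈ᵇ (I +ᴵ K))
  +ᴵ-full {I} {K} {a} {b} I-ideal K-ideal a∈I b∈K a+b≡1 x = from (T-+ᴵ {I = I} {K} x)
    ( (X * a) mod N , (X * b) mod N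
    , to ∈ᶻ⇔ (IsIdeal.*-closed I-ideal X a∈I)
    , to ∈ᶻ⇔ (IsIdeal.*-closed K-ideal X b∈K)
    , cong toℕ xa+xb≡x )
    where
    open ≡-Reasoning
    X : ℕ
    X = toℕ x
    xa+xb≡x : addₙ ((X * a) mod N) ((X * b) mod N) ≡ x
    xa+xb≡x = begin
      addₙ ((X * a) mod N) ((X * b) mod N)   ≡⟨ addₙ-mod (X * a) (X * b) ⟩
      (X * a + X * b) mod N                  ≡⟨ mod-cong (X * a + X * b) X (begin
        (X * a + X * b) % N                    ≡⟨ cong (_% N) (*-distribˡ-+ X a b) ⟨
        (X * (a + b)) % N                      ≡⟨ %-distribˡ-* X (a + b) N ⟩
        (X % N * ((a + b) % N)) % N            ≡⟨ cong (λ r → (X % N * r) % N) a+b≡1 ⟩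
        (X % N * (1 % N)) % N                  ≡⟨ %-distribˡ-* X 1 N ⟨
        (X * 1) % N                            ≡⟨ cong (_% N) (*-identityʳ X) ⟩
        X % N                                  ∎) ⟩
      X mod N                                ≡⟨ mod-toℕ x ⟩
      x                                      ∎

-- Products of distinct primes

prime≢1 : Prime p → p ≢ 1
prime≢1 p-prime = nonTrivial⇒≢1 {{prime⇒nonTrivial p-prime}}

prime∣prime⇒≡ : Prime q → Prime p → q ∣ p → q ≡ p
prime∣prime⇒≡ q-prime p-prime q∣p with prime⇒irreducible p-prime q∣p
... | inj₁ q≡1 = ⊥-elim (prime≢1 q-prime q≡1)
... | inj₂ q≡p = q≡p

prime∤⇒coprime : Prime q → ¬ q ∣ g → Coprime g q
prime∤⇒coprime q-prime q∤g (d∣g , d∣q) with prime⇒irreducible q-prime d∣q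
... | inj₁ d≡1    = d≡1
... | inj₂ refl   = ⊥-elim (q∤g d∣g)

∣m∣n⇒∣m∸n : ∀ {d m n} → d ∣ m → d ∣ n → n ≤ m → d ∣ m ∸ n
∣m∣n⇒∣m∸n {d} d∣m d∣n n≤m = ∣m+n∣m⇒∣n (subst (d ∣_) (sym (m+[n∸m]≡n n≤m)) d∣m) d∣n

squarefree-∣ : All Prime ps → Unique ps → g ∣ product ps → (∀ {q} → q ∈ ps → q ∣ g → q ∣ x) → g ∣ x
squarefree-∣ {[]} _ _ g∣1 _ rewrite ∣1⇒≡1 g∣1 = 1∣ _
squarefree-∣ {q ∷ qs} {g} (q-prime ∷ qs-prime) (q∉qs ∷ qs!) g∣qqs ∣x with q ∣? g
... | no q∤g = squarefree-∣ qs-prime qs! (coprime-divisor (prime∤⇒coprime q-prime q∤g) g∣qqs) (∣x ∘ there)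
... | yes (divides g′ refl) with ∣x (here refl) (divides g′ refl)
...   | divides x′ refl = *-monoˡ-∣ q (squarefree-∣ qs-prime qs! g′∣qs ∣x′)
  where
  instance _ = prime⇒nonZero q-prime
  g′∣qs : g′ ∣ product qs
  g′∣qs = *-cancelʳ-∣ q (subst (g′ * q ∣_) (*-comm q (product qs)) g∣qqs)
  ∣x′ : ∀ {r} → r ∈ qs → r ∣ g′ → r ∣ x′
  ∣x′ {r} r∈qs r∣g′ with euclidsLemma x′ q (All.lookup qs-prime r∈qs) (∣x (there r∈qs) (∣m⇒∣m*n q r∣g′))
  ... | inj₁ r∣x′ = r∣x′
  ... | inj₂ r∣q  = ⊥-elim (All.lookup q∉qs r∈qs (sym (prime∣prime⇒≡ (All.lookup qs-prime r∈qs) q-prime r∣q)))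

-- The witness is the quotient of the product by q; q ∤ c, as otherwise the whole product would divide c < q c.
∃-cofactor : All Prime ps → Unique ps → q ∈ ps → ∃ λ c → ¬ q ∣ c × (∀ {r} → r ∈ ps → r ≢ q → r ∣ c)
∃-cofactor {ps} {q} ps-prime ps! q∈ps = c , q∤c , r∣c
  where
  q-prime : Prime q
  q-prime = All.lookup ps-prime q∈ps
  q∣∏ : q ∣ product ps
  q∣∏ = ∈⇒∣product q∈ps
  c : ℕ
  c = quotient q∣∏
  ∏≡qc : product ps ≡ q * c
  ∏≡qc = m∣n⇒n≡m*quotient q∣∏
  r∣c : ∀ {r} → r ∈ ps → r ≢ q → r ∣ c
  r∣c {r} r∈ps r≢q with euclidsLemma q c (All.lookup ps-prime r∈ps) (subst (r ∣_) ∏≡qc (∈⇒∣product r∈ps))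
  ... | inj₁ r∣q = ⊥-elim (r≢q (prime∣prime⇒≡ (All.lookup ps-prime r∈ps) q-prime r∣q))
  ... | inj₂ r∣c′ = r∣c′
  q∤c : ¬ q ∣ c
  q∤c q∣c = <-irrefl refl (<-≤-trans c<qc (∣⇒≤ qc∣c))
    where
    instance
      _ = productOfPrimes≢0 ps-prime
      c≢0 : NonZero c
      c≢0 = quotient≢0 q∣∏
    qc∣c : q * c ∣ c
    qc∣c = subst (_∣ c) ∏≡qc (squarefree-∣ ps-prime ps! ∣-refl all∣c)
      where
      all∣c : ∀ {r} → r ∈ ps → r ∣ product ps → r ∣ c
      all∣c {r} r∈ps _ with r ≟ q
      ... | yes refl = q∣c
      ... | no r≢q   = r∣c r∈ps r≢q
    c<qc : q * c > c
    c<qc = subst (_> c) (*-comm c q) (m<m*n c q (nonTrivial⇒n>1 q {{prime⇒nonTrivial q-prime}}))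

-- Distances in finite graphs

module _ (G : FinGraph) where
  open FinGraph G

  -- Defs computes dist by a search function that it keeps private.  Abstracting the three
  -- arguments of that function turns the unfolded dist into a pattern, so that unification
  -- recovers the function as `search`.  The 0 is listed first because it is abstracted last,
  -- when the 0 inside `length V` has already been abstracted together with `length V`.
  private
    module DistanceSearch (u v : Vtx) where
      mutual
        search : ℕ → ℕ → (ℕ → Bool) → ℕ
        search = _

        dist≡search : dist G u v ≡ search (length V) 0 (λ m → reach G m u v)
        dist≡search with 0 | length V | (λ m → reach G m u v)
        ... | _ | _ | _ = refl

      search≡ : ∀ {P : ℕ → Bool} {d} → (∀ m → T (P m) ⇔ d ≤ m) →
                ∀ f s → s ≤ d → d ≤ s + f → search f s P ≡ d
      search≡ {d = d} P⇔ zero s s≤d d≤s+0 = ≤-antisym s≤d (subst (d ≤_) (+-identityʳ s) d≤s+0)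
      search≡ {P} {d} P⇔ (suc f) s s≤d d≤s+1+f with P s in Ps
      ... | true  = ≤-antisym s≤d (to (P⇔ s) (subst T (sym Ps) _))
      ... | false = search≡ P⇔ f (suc s) (≤∧≢⇒< s≤d s≢d) (subst (d ≤_) (+-suc s f) d≤s+1+f)
        where
        s≢d : s ≢ d
        s≢d refl = subst T Ps (from (P⇔ s) ≤-refl)

  dist≡ : ∀ {u v} d → d ≤ length V → (∀ m → T (reach G m u v) ⇔ d ≤ m) → dist G u v ≡ d
  dist≡ {u} {v} d d≤|V| reach⇔ = trans dist≡search (search≡ reach⇔ (length V) 0 z≤n d≤|V|)
    where open DistanceSearch u v

  -- As for dist, unification recovers the local function by which Defs defines pairSum.
  private
    module PairSum (f : Vtx → Vtx → ℕ) where
      mutual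
        pairs : List Vtx → ℕ
        pairs = _

        pairSum≡pairs : pairSum G f ≡ pairs V
        pairSum≡pairs with V
        ... | _ = refl

      pairs-double : ∀ xs → (∀ {u v} → u ∈ xs → v ∈ xs → f u v ≡ f v u) → (∀ {u} → u ∈ xs → f u u ≡ 0) →
                     2 * pairs xs ≡ ∑[ u ∈ xs ] ∑[ v ∈ xs ] f u v
      pairs-double []       _   _    = refl
      pairs-double (x ∷ xs) f-sym diag = begin
        2 * (row + pairs xs)                   ≡⟨ *-distribˡ-+ 2 row (pairs xs) ⟩
        2 * row + 2 * pairs xs                 ≡⟨ cong (2 * row +_) (pairs-double xs (λ u∈ v∈ → f-sym (there u∈) (there v∈)) (diag ∘ there)) ⟩
        2 * row + rest                         ≡⟨ rearrange row rest ⟩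
        0 + row + (row + rest)                 ≡⟨ cong₂ (λ a b → a + row + (b + rest)) (sym (diag (here refl)))
                                                        (∑-cong xs (λ u∈ → f-sym (here refl) (there u∈))) ⟩
        f x x + row + (column + rest)          ≡⟨ cong (f x x + row +_) (∑-+ (λ u → f u x) (λ u → ∑ xs (f u)) xs) ⟨
        ∑[ u ∈ x ∷ xs ] ∑[ v ∈ x ∷ xs ] f u v  ∎
        where
        open ≡-Reasoning
        row column rest : ℕ
        row    = ∑ xs (f x)
        column = ∑[ u ∈ xs ] f u x
        rest   = ∑[ u ∈ xs ] ∑[ v ∈ xs ] f u v
        rearrange : ∀ a b → 2 * a + b ≡ 0 + a + (a + b)
        rearrange = solve-∀

  pairSum-double : ∀ (f : Vtx → Vtx → ℕ) → (∀ {u v} → u ∈ V → v ∈ V → f u v ≡ f v u) → (∀ {u} → u ∈ V → f u u ≡ 0) →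
                   2 * pairSum G f ≡ ∑[ u ∈ V ] ∑[ v ∈ V ] f u v
  pairSum-double f f-sym diag = trans (cong (2 *_) pairSum≡pairs) (pairs-double V f-sym diag)
    where open PairSum f

-- δ has the three defining properties of the layers of a breadth-first search, so it is the distance.
module Layering (G : FinGraph) {A : Set} (P : List A) (ψ : A → FinGraph.Vtx G)
                (V↭ψP : FinGraph.V G ↭ map ψ P) (δ : A → A → ℕ)
                (δ≡0⇔ : ∀ {S U} → S ∈ P → U ∈ P → T (FinGraph._≟ᵥ_ G (ψ S) (ψ U)) ⇔ δ S U ≡ 0)
                (δ-step : ∀ {S W U} → S ∈ P → W ∈ P → U ∈ P → T (FinGraph.adj G (ψ W) (ψ U)) → δ S U ≤ suc (δ S W))
                (δ-pred : ∀ {S U d} → S ∈ P → U ∈ P → δ S U ≡ suc d →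
                          ∃ λ W → W ∈ P × δ S W ≡ d × T (FinGraph.adj G (ψ W) (ψ U)))
  where
  open FinGraph G

  ∈V⇒ψ : ∀ {u} → u ∈ V → ∃ λ S → S ∈ P × u ≡ ψ S
  ∈V⇒ψ u∈V = ∈-map⁻ ψ (∈-resp-↭ V↭ψP u∈V)

  reach⇔ : ∀ m {S U} → S ∈ P → U ∈ P → T (reach G m (ψ S) (ψ U)) ⇔ δ S U ≤ m
  reach⇔ zero    S∈ U∈ = mk⇔ (≤-reflexive ∘ to (δ≡0⇔ S∈ U∈)) (from (δ≡0⇔ S∈ U∈) ∘ n≤0⇒n≡0)
  reach⇔ (suc m) {S} {U} S∈ U∈ = mk⇔ reached⇒ ⇒reached
    where
    reached⇒ : T (reach G (suc m) (ψ S) (ψ U)) → δ S U ≤ suc m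
    reached⇒ r with to (T-∨ {reach G m (ψ S) (ψ U)}) r
    ... | inj₁ r′ = m≤n⇒m≤1+n (to (reach⇔ m S∈ U∈) r′)
    ... | inj₂ r′ with find (Any.map⁻ (Any-resp-↭ V↭ψP (any⁻ _ V r′)))
    ...   | W , W∈ , rW∧adj with to T-∧ rW∧adj
    ...     | rW , adj-WU = ≤-trans (δ-step S∈ W∈ U∈ adj-WU) (s≤s (to (reach⇔ m S∈ W∈) rW))
    ⇒reached : δ S U ≤ suc m → T (reach G (suc m) (ψ S) (ψ U))
    ⇒reached δ≤1+m with δ S U ≤? m
    ... | yes δ≤m = from (T-∨ {reach G m (ψ S) (ψ U)}) (inj₁ (from (reach⇔ m S∈ U∈) δ≤m))
    ... | no δ≰m with δ-pred S∈ U∈ (≤-antisym δ≤1+m (≰⇒> δ≰m))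
    ...   | W , W∈ , δSW≡m , adj-WU =
      from (T-∨ {reach G m (ψ S) (ψ U)})
        (inj₂ (any⁺ _ (Any-resp-↭ (↭-sym V↭ψP) (Any.map⁺ (lose W∈ (from T-∧
          (from (reach⇔ m S∈ W∈) (≤-reflexive δSW≡m) , adj-WU)))))))

  -- Following predecessors from U back to S gives δ S U + 1 distinct elements of P.
  layers : ∀ d {S U} → S ∈ P → U ∈ P → δ S U ≡ d →
           ∃ λ ws → Unique ws × (∀ {W} → W ∈ ws → W ∈ P) × All (λ W → δ S W ≤ d) ws × length ws ≡ suc d
  layers zero {U = U} S∈ U∈ δ≡0 = U ∷ [] , [] ∷ [] , (λ { (here refl) → U∈ }) , ≤-reflexive δ≡0 ∷ [] , refl
  layers (suc d) {S} {U} S∈ U∈ δ≡1+d with δ-pred S∈ U∈ δ≡1+d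
  ... | W , W∈ , δSW≡d , _ with layers d S∈ W∈ δSW≡d
  ...   | ws , ws! , ws⊆P , ws≤d , |ws|≡ =
    U ∷ ws , All.map U≢ ws≤d ∷ ws! , (λ { (here refl) → U∈ ; (there W∈ws) → ws⊆P W∈ws }) ,
    ≤-reflexive δ≡1+d ∷ All.map m≤n⇒m≤1+n ws≤d , cong suc |ws|≡
    where
    U≢ : ∀ {W′} → δ S W′ ≤ d → U ≢ W′
    U≢ δSW′≤d refl = <⇒≢ (s≤s δSW′≤d) δ≡1+d

  δ<|V| : ∀ {S U} → S ∈ P → U ∈ P → length V > δ S U
  δ<|V| {S} {U} S∈ U∈ with layers (δ S U) S∈ U∈ refl
  ... | ws , ws! , ws⊆P , _ , |ws|≡ = begin
    suc (δ S U)       ≡⟨ |ws|≡ ⟨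
    length ws         ≤⟨ unique⊆⇒length≤ ws! ws⊆P ⟩
    length P          ≡⟨ length-map ψ P ⟨
    length (map ψ P)  ≡⟨ ↭-length V↭ψP ⟨
    length V          ∎
    where open ≤-Reasoning

  dist-ψ : ∀ {S U} → S ∈ P → U ∈ P → dist G (ψ S) (ψ U) ≡ δ S U
  dist-ψ S∈ U∈ = dist≡ G _ (<⇒≤ (δ<|V| S∈ U∈)) (λ m → reach⇔ m S∈ U∈)

  connected : Connected G
  connected = to T-≡ (all⁻ _ (All.tabulate λ u∈ → all⁻ _ (All.tabulate λ v∈ → reached u∈ v∈)))
    where
    reached : ∀ {u v} → u ∈ V → v ∈ V → T (reach G (length V) u v)
    reached u∈ v∈ with ∈V⇒ψ u∈ | ∈V⇒ψ v∈
    ... | S , S∈ , refl | U , U∈ , refl = from (reach⇔ (length V) S∈ U∈) (<⇒≤ (δ<|V| S∈ U∈))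

  ∑-V : ∀ (g : Vtx → ℕ) → ∑ V g ≡ ∑[ S ∈ P ] g (ψ S)
  ∑-V g = trans (∑-↭ g V↭ψP) (∑-map g ψ P)

  doubled-hyperWiener : (∀ S U → δ S U ≡ δ U S) → (∀ S → δ S S ≡ 0) →
    2 * (wiener G + pairSum G (λ u v → dist G u v * dist G u v)) ≡ ∑[ S ∈ P ] ∑[ U ∈ P ] (δ S U + δ S U * δ S U)
  doubled-hyperWiener δ-sym δ-diag = begin
    2 * (wiener G + pairSum G d²)
      ≡⟨ *-distribˡ-+ 2 (wiener G) (pairSum G d²) ⟩
    2 * pairSum G d + 2 * pairSum G d²
      ≡⟨ cong₂ _+_ (pairSum-double G d d-sym d-diag)
                   (pairSum-double G d² (λ u∈ v∈ → cong₂ _*_ (d-sym u∈ v∈) (d-sym u∈ v∈))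
                                        (λ u∈ → cong₂ _*_ (d-diag u∈) (d-diag u∈))) ⟩
    ∑[ u ∈ V ] ∑[ v ∈ V ] d u v + ∑[ u ∈ V ] ∑[ v ∈ V ] d² u v
      ≡⟨ ∑-+ (λ u → ∑[ v ∈ V ] d u v) (λ u → ∑[ v ∈ V ] d² u v) V ⟨
    ∑[ u ∈ V ] (∑[ v ∈ V ] d u v + ∑[ v ∈ V ] d² u v)
      ≡⟨ ∑-cong V (λ {u} _ → sym (∑-+ (d u) (d² u) V)) ⟩
    ∑[ u ∈ V ] ∑[ v ∈ V ] (d u v + d² u v)
      ≡⟨ trans (∑-V _) (∑-cong P (λ {S} _ → ∑-V (λ v → d (ψ S) v + d² (ψ S) v))) ⟩
    ∑[ S ∈ P ] ∑[ U ∈ P ] (d (ψ S) (ψ U) + d² (ψ S) (ψ U))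
      ≡⟨ ∑-cong P (λ S∈ → ∑-cong P (λ U∈ → cong (λ x → x + x * x) (dist-ψ S∈ U∈))) ⟩
    ∑[ S ∈ P ] ∑[ U ∈ P ] (δ S U + δ S U * δ S U) ∎
    where
    open ≡-Reasoning
    d d² : Vtx → Vtx → ℕ
    d = dist G
    d² u v = dist G u v * dist G u v
    d-sym : ∀ {u v} → u ∈ V → v ∈ V → d u v ≡ d v u
    d-sym u∈ v∈ with ∈V⇒ψ u∈ | ∈V⇒ψ v∈
    ... | S , S∈ , refl | U , U∈ , refl = trans (dist-ψ S∈ U∈) (trans (δ-sym S U) (sym (dist-ψ U∈ S∈)))
    d-diag : ∀ {u} → u ∈ V → d u u ≡ 0
    d-diag u∈ with ∈V⇒ψ u∈
    ... | S , S∈ , refl = trans (dist-ψ S∈ S∈) (δ-diag S)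

-- The disjointness graph on proper subsets

infix 4 _≟ˢ_

_≟ˢ_ : DecidableEquality (Subset k)
_≟ˢ_ = ≡-dec Bool._≟_

Proper : Subset k → Set
Proper S = S ≢ ⊥ × S ≢ ⊤

proper? : ∀ (S : Subset k) → Dec (Proper S)
proper? S = ¬? (S ≟ˢ ⊥) ×-dec ¬? (S ≟ˢ ⊤)

properSubsets : ∀ k → List (Subset k)
properSubsets k = filter proper? (allSubsets k)

∈-allSubsets : ∀ (S : Subset k) → S ∈ allSubsets k
∈-allSubsets []          = here refl
∈-allSubsets (true ∷ S)  = ∈-++⁺ˡ (∈-map⁺ (true ∷_) (∈-allSubsets S))
∈-allSubsets (false ∷ S) = ∈-++⁺ʳ _ (∈-map⁺ (false ∷_) (∈-allSubsets S))

allSubsets-unique : ∀ k → Unique (allSubsets k)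
allSubsets-unique zero    = [] ∷ []
allSubsets-unique (suc k) = Unique.++⁺ (Unique.map⁺ (proj₂ ∘ ∷-injective) (allSubsets-unique k))
                                       (Unique.map⁺ (proj₂ ∘ ∷-injective) (allSubsets-unique k))
                                       different-heads
  where
  different-heads : ∀ {S} → ¬ (S ∈ map (true ∷_) (allSubsets k) × S ∈ map (false ∷_) (allSubsets k))
  different-heads (S∈ , S∈′) with ∈-map⁻ (true ∷_) S∈ | ∈-map⁻ (false ∷_) S∈′
  ... | _ , _ , refl | _ , _ , ()

∈-properSubsets : ∀ {k} {S : Subset k} → S ∈ properSubsets k ⇔ Proper S
∈-properSubsets {k} {S} = mk⇔ (proj₂ ∘ ∈-filter⁻ proper? {xs = allSubsets k}) (∈-filter⁺ proper? (∈-allSubsets S))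

properSubsets-unique : ∀ k → Unique (properSubsets k)
properSubsets-unique k = Unique.filter⁺ proper? (allSubsets-unique k)

module _ {k : ℕ} where
  open BooleanAlgebraProperties (∪-∩-booleanAlgebra k) using (¬-involutive; deMorgan₂; ¬⊥≈⊤; ¬⊤≈⊥)

  ∁≡⊥⇒≡⊤ : ∀ {S : Subset k} → ∁ S ≡ ⊥ → S ≡ ⊤
  ∁≡⊥⇒≡⊤ {S} ∁S≡⊥ = trans (sym (¬-involutive S)) (trans (cong ∁ ∁S≡⊥) ¬⊥≈⊤)

  ∁≡⊤⇒≡⊥ : ∀ {S : Subset k} → ∁ S ≡ ⊤ → S ≡ ⊥
  ∁≡⊤⇒≡⊥ {S} ∁S≡⊤ = trans (sym (¬-involutive S)) (trans (cong ∁ ∁S≡⊤) ¬⊤≈⊥)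

  ∁-proper : ∀ {S : Subset k} → Proper S → Proper (∁ S)
  ∁-proper (S≢⊥ , S≢⊤) = S≢⊤ ∘ ∁≡⊥⇒≡⊤ , S≢⊥ ∘ ∁≡⊤⇒≡⊥

  p∩∁[p∪q]≡⊥ : ∀ (S U : Subset k) → S ∩ ∁ (S ∪ U) ≡ ⊥
  p∩∁[p∪q]≡⊥ S U = begin
    S ∩ ∁ (S ∪ U)      ≡⟨ cong (S ∩_) (deMorgan₂ S U) ⟩
    S ∩ (∁ S ∩ ∁ U)    ≡⟨ ∩-assoc S (∁ S) (∁ U) ⟨
    (S ∩ ∁ S) ∩ ∁ U    ≡⟨ cong (_∩ ∁ U) (∩-inverseʳ S) ⟩
    ⊥ ∩ ∁ U            ≡⟨ ∩-zeroˡ (∁ U) ⟩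
    ⊥                  ∎
    where open ≡-Reasoning

  ∁[p∪q]∩q≡⊥ : ∀ (S U : Subset k) → ∁ (S ∪ U) ∩ U ≡ ⊥
  ∁[p∪q]∩q≡⊥ S U = begin
    ∁ (S ∪ U) ∩ U    ≡⟨ ∩-comm (∁ (S ∪ U)) U ⟩
    U ∩ ∁ (S ∪ U)    ≡⟨ cong (λ X → U ∩ ∁ X) (∪-comm S U) ⟩
    U ∩ ∁ (U ∪ S)    ≡⟨ p∩∁[p∪q]≡⊥ U S ⟩
    ⊥                ∎
    where open ≡-Reasoning

  p∪q≡⊥⇒p≡⊥ : ∀ {S U : Subset k} → S ∪ U ≡ ⊥ → S ≡ ⊥
  p∪q≡⊥⇒p≡⊥ {S} {U} S∪U≡⊥ = begin
    S                ≡⟨ ∩-abs-∪ S U ⟨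
    S ∩ (S ∪ U)      ≡⟨ cong (S ∩_) S∪U≡⊥ ⟩
    S ∩ ⊥            ≡⟨ ∩-zeroʳ S ⟩
    ⊥                ∎
    where open ≡-Reasoning

  disjoint-from-cover⇒≡⊥ : ∀ {W S U : Subset k} → W ∩ S ≡ ⊥ → W ∩ U ≡ ⊥ → S ∪ U ≡ ⊤ → W ≡ ⊥
  disjoint-from-cover⇒≡⊥ {W} {S} {U} W∩S≡⊥ W∩U≡⊥ S∪U≡⊤ = begin
    W                    ≡⟨ ∩-identityʳ W ⟨
    W ∩ ⊤                ≡⟨ cong (W ∩_) S∪U≡⊤ ⟨
    W ∩ (S ∪ U)          ≡⟨ ∩-distribˡ-∪ W S U ⟩
    (W ∩ S) ∪ (W ∩ U)    ≡⟨ cong₂ _∪_ W∩S≡⊥ W∩U≡⊥ ⟩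
    ⊥ ∪ ⊥                ≡⟨ ∪-idem ⊥ ⟩
    ⊥                    ∎
    where open ≡-Reasoning

  covers-disjoint⇒≡⊤ : ∀ {S U V : Subset k} → S ∪ U ≡ ⊤ → S ∪ V ≡ ⊤ → U ∩ V ≡ ⊥ → S ≡ ⊤
  covers-disjoint⇒≡⊤ {S} {U} {V} S∪U≡⊤ S∪V≡⊤ U∩V≡⊥ = begin
    S                    ≡⟨ ∪-identityʳ S ⟨
    S ∪ ⊥                ≡⟨ cong (S ∪_) U∩V≡⊥ ⟨
    S ∪ (U ∩ V)          ≡⟨ ∪-distribˡ-∩ S U V ⟩
    (S ∪ U) ∩ (S ∪ V)    ≡⟨ cong₂ _∩_ S∪U≡⊤ S∪V≡⊤ ⟩
    ⊤ ∩ ⊤                ≡⟨ ∩-idem ⊤ ⟩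
    ⊤                    ∎
    where open ≡-Reasoning

  -- The distance between proper subsets S and U in the graph in which disjoint subsets are adjacent.
  distance : Subset k → Subset k → ℕ
  distance S U = if does (S ≟ˢ U) then 0 else if does (S ∩ U ≟ˢ ⊥) then 1 else if does (S ∪ U ≟ˢ ⊤) then 3 else 2

  distance-≤3 : ∀ (S U : Subset k) → distance S U ≤ 3
  distance-≤3 S U with does (S ≟ˢ U) | does (S ∩ U ≟ˢ ⊥) | does (S ∪ U ≟ˢ ⊤)
  ... | true  | _     | _     = z≤n
  ... | false | true  | _     = s≤s z≤n
  ... | false | false | true  = ≤-refl
  ... | false | false | false = s≤s (s≤s z≤n)

  distance≡0⇔≡ : ∀ {S U : Subset k} → distance S U ≡ 0 ⇔ S ≡ U
  distance≡0⇔≡ {S} {U} with S ≟ˢ U | does (S ∩ U ≟ˢ ⊥) | does (S ∪ U ≟ˢ ⊤)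
  ... | yes S≡U | _     | _     = mk⇔ (λ _ → S≡U) (λ _ → refl)
  ... | no S≢U  | true  | _     = mk⇔ (λ ()) (⊥-elim ∘ S≢U)
  ... | no S≢U  | false | true  = mk⇔ (λ ()) (⊥-elim ∘ S≢U)
  ... | no S≢U  | false | false = mk⇔ (λ ()) (⊥-elim ∘ S≢U)

  distance-sym : ∀ (S U : Subset k) → distance S U ≡ distance U S
  distance-sym S U rewrite ∩-comm S U | ∪-comm S U with S ≟ˢ U | U ≟ˢ S
  ... | yes refl | yes _    = refl
  ... | yes refl | no U≢S   = ⊥-elim (U≢S refl)
  ... | no S≢U   | yes refl = ⊥-elim (S≢U refl)
  ... | no _     | no _     = refl

  distance≡1 : ∀ {S U : Subset k} → S ≢ U → S ∩ U ≡ ⊥ → distance S U ≡ 1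
  distance≡1 {S} {U} S≢U S∩U≡⊥ rewrite dec-false (S ≟ˢ U) S≢U | dec-true (S ∩ U ≟ˢ ⊥) S∩U≡⊥ = refl

  distance≡2 : ∀ {S U : Subset k} → S ≢ U → S ∩ U ≢ ⊥ → S ∪ U ≢ ⊤ → distance S U ≡ 2
  distance≡2 {S} {U} S≢U S∩U≢⊥ S∪U≢⊤
    rewrite dec-false (S ≟ˢ U) S≢U | dec-false (S ∩ U ≟ˢ ⊥) S∩U≢⊥ | dec-false (S ∪ U ≟ˢ ⊤) S∪U≢⊤ = refl

  distance-≤1 : ∀ {S U : Subset k} → S ∩ U ≡ ⊥ → distance S U ≤ 1
  distance-≤1 {S} {U} S∩U≡⊥ rewrite dec-true (S ∩ U ≟ˢ ⊥) S∩U≡⊥ with does (S ≟ˢ U)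
  ... | true  = z≤n
  ... | false = ≤-refl

  distance-≤2 : ∀ {S U : Subset k} → S ∪ U ≢ ⊤ → distance S U ≤ 2
  distance-≤2 {S} {U} S∪U≢⊤ rewrite dec-false (S ∪ U ≟ˢ ⊤) S∪U≢⊤ with does (S ≟ˢ U) | does (S ∩ U ≟ˢ ⊥)
  ... | true  | _     = z≤n
  ... | false | true  = s≤s z≤n
  ... | false | false = ≤-refl

  distance-step : ∀ (S : Subset k) {W U} → W ≢ ⊥ → W ∩ U ≡ ⊥ → distance S U ≤ suc (distance S W)
  distance-step S {W} {U} W≢⊥ W∩U≡⊥ with S ≟ˢ W
  ... | yes refl = distance-≤1 W∩U≡⊥
  ... | no _ with S ∩ W ≟ˢ ⊥
  ...   | yes S∩W≡⊥ = distance-≤2 λ S∪U≡⊤ → W≢⊥ (disjoint-from-cover⇒≡⊥ (trans (∩-comm W S) S∩W≡⊥) W∩U≡⊥ S∪U≡⊤)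
  ...   | no _ with does (S ∪ W ≟ˢ ⊤)
  ...     | true  = m≤n⇒m≤1+n (distance-≤3 S U)
  ...     | false = distance-≤3 S U

  distance-pred : ∀ {S U : Subset k} {d} → Proper S → Proper U → distance S U ≡ suc d →
                  ∃ λ W → Proper W × distance S W ≡ d × W ∩ U ≡ ⊥
  distance-pred {S} {U} S-proper U-proper d+1≡ with S ≟ˢ U | S ∩ U ≟ˢ ⊥ | S ∪ U ≟ˢ ⊤
  distance-pred S-proper U-proper () | yes _ | _ | _
  distance-pred {S} S-proper U-proper refl | no S≢U | yes S∩U≡⊥ | _ =
    S , S-proper , from (distance≡0⇔≡ {S = S}) refl , S∩U≡⊥
  distance-pred {S} {U} (S≢⊥ , S≢⊤) U-proper refl | no S≢U | no S∩U≢⊥ | no S∪U≢⊤ =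
    ∁ (S ∪ U) , W-proper , distance≡1 S≢W (p∩∁[p∪q]≡⊥ S U) , ∁[p∪q]∩q≡⊥ S U
    where
    W-proper : Proper (∁ (S ∪ U))
    W-proper = S∪U≢⊤ ∘ ∁≡⊥⇒≡⊤ , S≢⊥ ∘ p∪q≡⊥⇒p≡⊥ ∘ ∁≡⊤⇒≡⊥
    S≢W : S ≢ ∁ (S ∪ U)
    S≢W S≡W = S≢⊥ (trans (sym (∩-idem S)) (trans (cong (S ∩_) S≡W) (p∩∁[p∪q]≡⊥ S U)))
  distance-pred {S} {U} (S≢⊥ , S≢⊤) U-proper@(_ , U≢⊤) refl | no S≢U | no S∩U≢⊥ | yes S∪U≡⊤ =
    ∁ U , ∁-proper U-proper , distance≡2 S≢∁U S∩∁U≢⊥ S∪∁U≢⊤ , ∩-inverseˡ U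
    where
    S≢∁U : S ≢ ∁ U
    S≢∁U S≡∁U = S∩U≢⊥ (trans (cong (_∩ U) S≡∁U) (∩-inverseˡ U))
    S∩∁U≢⊥ : S ∩ ∁ U ≢ ⊥
    S∩∁U≢⊥ S∩∁U≡⊥ = U≢⊤ (covers-disjoint⇒≡⊤ (trans (∪-comm U S) S∪U≡⊤) (∪-inverseʳ U) S∩∁U≡⊥)
    S∪∁U≢⊤ : S ∪ ∁ U ≢ ⊤
    S∪∁U≢⊤ S∪∁U≡⊤ = S≢⊤ (covers-disjoint⇒≡⊤ S∪U≡⊤ S∪∁U≡⊤ (∩-inverseʳ U))

  distance≡3 : ∀ {S U : Subset k} → S ≢ U → S ∩ U ≢ ⊥ → S ∪ U ≡ ⊤ → distance S U ≡ 3
  distance≡3 {S} {U} S≢U S∩U≢⊥ S∪U≡⊤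
    rewrite dec-false (S ≟ˢ U) S≢U | dec-false (S ∩ U ≟ˢ ⊥) S∩U≢⊥ | dec-true (S ∪ U ≟ˢ ⊤) S∪U≡⊤ = refl

≢⊥⇒∈ : ∀ {S : Subset k} → S ≢ ⊥ → ∃ λ i → T (i ∈ᵇ S)
≢⊥⇒∈ {S = []}        S≢⊥ = ⊥-elim (S≢⊥ refl)
≢⊥⇒∈ {S = true ∷ S}  _   = zero , _
≢⊥⇒∈ {S = false ∷ S} S≢⊥ with ≢⊥⇒∈ (S≢⊥ ∘ cong (false ∷_))
... | i , i∈S = suc i , i∈S

≢⊤⇒∉ : ∀ {S : Subset k} → S ≢ ⊤ → ∃ λ i → ¬ T (i ∈ᵇ S)
≢⊤⇒∉ {S = []}        S≢⊤ = ⊥-elim (S≢⊤ refl)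
≢⊤⇒∉ {S = false ∷ S} _   = zero , λ ()
≢⊤⇒∉ {S = true ∷ S}  S≢⊤ with ≢⊤⇒∉ (S≢⊤ ∘ cong (true ∷_))
... | i , i∉S = suc i , i∉S

∈⊤ : ∀ (i : Fin k) → T (i ∈ᵇ ⊤)
∈⊤ i rewrite lookup-replicate i true = _

∉⊥ : ∀ (i : Fin k) → ¬ T (i ∈ᵇ ⊥)
∉⊥ i rewrite lookup-replicate i false = λ ()

∈∁⇔ : ∀ {S : Subset k} i → T (i ∈ᵇ ∁ S) ⇔ (¬ T (i ∈ᵇ S))
∈∁⇔ {S = S} i rewrite lookup-map i not S = T-not

-- Counting subsets

𝟙 : Bool → ℕ
𝟙 b = if b then 1 else 0

double : ∀ x → x + x ≡ 2 * x
double x = cong (x +_) (sym (+-identityʳ x))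

∑-allSubsets-suc : ∀ k (f : Subset (suc k) → ℕ) →
                   ∑ (allSubsets (suc k)) f ≡ ∑ (allSubsets k) (f ∘ (true ∷_)) + ∑ (allSubsets k) (f ∘ (false ∷_))
∑-allSubsets-suc k f = trans (∑-++ f (map (true ∷_) (allSubsets k)) _)
                             (cong₂ _+_ (∑-map f _ (allSubsets k)) (∑-map f _ (allSubsets k)))

count-all : ∀ k → ∑[ U ∈ allSubsets k ] 1 ≡ 2 ^ k
count-all zero    = refl
count-all (suc k) = trans (∑-allSubsets-suc k (λ _ → 1)) (trans (cong₂ _+_ (count-all k) (count-all k)) (double (2 ^ k)))

count-disjoint : ∀ {k} (S : Subset k) → ∑[ U ∈ allSubsets k ] 𝟙 (does (S ∩ U ≟ˢ ⊥)) ≡ 2 ^ ∣ ∁ S ∣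
count-disjoint []               = refl
count-disjoint {suc k} (true ∷ S)  = trans (∑-allSubsets-suc k _) (cong₂ _+_ (∑-zero (allSubsets k)) (count-disjoint S))
count-disjoint {suc k} (false ∷ S) =
  trans (∑-allSubsets-suc k _) (trans (cong₂ _+_ (count-disjoint S) (count-disjoint S)) (double (2 ^ ∣ ∁ S ∣)))

count-covering : ∀ {k} (S : Subset k) → ∑[ U ∈ allSubsets k ] 𝟙 (does (S ∪ U ≟ˢ ⊤)) ≡ 2 ^ ∣ S ∣
count-covering []               = refl
count-covering {suc k} (true ∷ S)  =
  trans (∑-allSubsets-suc k _) (trans (cong₂ _+_ (count-covering S) (count-covering S)) (double (2 ^ ∣ S ∣)))
count-covering {suc k} (false ∷ S) =
  trans (∑-allSubsets-suc k _) (trans (cong₂ _+_ (count-covering S) (∑-zero (allSubsets k))) (+-identityʳ _))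

count-complement : ∀ {k} (S : Subset k) → ∑[ U ∈ allSubsets k ] 𝟙 (does (S ∩ U ≟ˢ ⊥) ∧ does (S ∪ U ≟ˢ ⊤)) ≡ 1
count-complement []               = refl
count-complement {suc k} (true ∷ S)  = trans (∑-allSubsets-suc k _) (cong₂ _+_ (∑-zero (allSubsets k)) (count-complement S))
count-complement {suc k} (false ∷ S) = trans (∑-allSubsets-suc k _) (cong₂ _+_ (count-complement S)
  (trans (∑-cong (allSubsets k) λ {U} _ → cong 𝟙 (∧-zeroʳ (does (S ∩ U ≟ˢ ⊥)))) (∑-zero (allSubsets k))))

count-equal : ∀ {k} (S : Subset k) → ∑[ U ∈ allSubsets k ] 𝟙 (does (S ≟ˢ U)) ≡ 1
count-equal []               = refl
count-equal {suc k} (true ∷ S)  = trans (∑-allSubsets-suc k _) (cong₂ _+_ (count-equal S) (∑-zero (allSubsets k)))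
count-equal {suc k} (false ∷ S) = trans (∑-allSubsets-suc k _) (cong₂ _+_ (∑-zero (allSubsets k)) (count-equal S))

hyperWienerWeight : ℕ → ℕ
hyperWienerWeight d = d + d * d

module _ {k : ℕ} where

  allSubsets↭ : (⊥ {k}) ≢ ⊤ → allSubsets k ↭ ⊥ ∷ ⊤ ∷ properSubsets k
  allSubsets↭ ⊥≢⊤ = unique-⇔⇒↭ (allSubsets-unique k)
                               ((⊥≢⊤ ∷ All.tabulate ⊥≢proper) ∷ All.tabulate ⊤≢proper ∷ properSubsets-unique k)
                               (λ {S} → mk⇔ (λ _ → classify S) (λ _ → ∈-allSubsets S))
    where
    ⊥≢proper : ∀ {S} → S ∈ properSubsets k → ⊥ ≢ S
    ⊥≢proper S∈ ⊥≡S = proj₁ (to ∈-properSubsets S∈) (sym ⊥≡S)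
    ⊤≢proper : ∀ {S} → S ∈ properSubsets k → ⊤ ≢ S
    ⊤≢proper S∈ ⊤≡S = proj₂ (to ∈-properSubsets S∈) (sym ⊤≡S)
    classify : ∀ S → S ∈ ⊥ ∷ ⊤ ∷ properSubsets k
    classify S with S ≟ˢ ⊥ | S ≟ˢ ⊤
    ... | yes S≡⊥ | _       = here S≡⊥
    ... | no _    | yes S≡⊤ = there (here S≡⊤)
    ... | no S≢⊥  | no S≢⊤  = there (there (from ∈-properSubsets (S≢⊥ , S≢⊤)))

  ∑-allSubsets : (⊥ {k}) ≢ ⊤ → ∀ (f : Subset k → ℕ) → ∑ (allSubsets k) f ≡ f ⊥ + (f ⊤ + ∑ (properSubsets k) f)
  ∑-allSubsets ⊥≢⊤ f = ∑-↭ f (allSubsets↭ ⊥≢⊤)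

  proper⇒⊥≢⊤ : ∀ {S : Subset k} → Proper S → (⊥ {k}) ≢ ⊤
  proper⇒⊥≢⊤ {[]}    (S≢⊥ , _) _  = S≢⊥ refl
  proper⇒⊥≢⊤ {_ ∷ _} _         ()

  -- hyperWienerWeight (distance S U)
  --   = 6 + 6 [S ∪ U = ⊤] - 4 [S ∩ U = ⊥] - 6 [S ∩ U = ⊥ and S ∪ U = ⊤] - 6 [S = U],
  -- with the terms moved so that no subtraction occurs.
  hyperWienerWeight-identity : ∀ {S : Subset k} → Proper S → ∀ U →
    hyperWienerWeight (distance S U) + 4 * 𝟙 (does (S ∩ U ≟ˢ ⊥))
      + 6 * 𝟙 (does (S ∩ U ≟ˢ ⊥) ∧ does (S ∪ U ≟ˢ ⊤)) + 6 * 𝟙 (does (S ≟ˢ U))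
      ≡ 6 + 6 * 𝟙 (does (S ∪ U ≟ˢ ⊤))
  hyperWienerWeight-identity {S} (S≢⊥ , S≢⊤) U with S ≟ˢ U
  ... | yes refl rewrite ∩-idem S | ∪-idem S | dec-false (S ≟ˢ ⊥) S≢⊥ | dec-false (S ≟ˢ ⊤) S≢⊤ = refl
  ... | no _ with does (S ∩ U ≟ˢ ⊥) | does (S ∪ U ≟ˢ ⊤)
  ...   | true  | true  = refl
  ...   | true  | false = refl
  ...   | false | true  = refl
  ...   | false | false = refl

  ∑-hyperWienerWeight : ∀ {S : Subset k} → Proper S →
    ∑[ U ∈ properSubsets k ] hyperWienerWeight (distance S U) + (4 * 2 ^ ∣ ∁ S ∣ + 26) ≡ 6 * 2 ^ k + 6 * 2 ^ ∣ S ∣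
  ∑-hyperWienerWeight {S} S-proper@(S≢⊥ , S≢⊤) = begin
    P + (4 * 2 ^ ∣ ∁ S ∣ + 26)                                   ≡⟨ rearrange P (2 ^ ∣ ∁ S ∣) ⟩
    hyperWienerWeight 1 + (hyperWienerWeight 3 + P) + 4 * 2 ^ ∣ ∁ S ∣ + 6 * 1 + 6 * 1
      ≡⟨ cong₂ (λ a b → hyperWienerWeight a + (hyperWienerWeight b + P) + 4 * 2 ^ ∣ ∁ S ∣ + 6 * 1 + 6 * 1)
               (sym (distance≡1 S≢⊥ (∩-zeroʳ S)))
               (sym (distance≡3 S≢⊤ (λ S∩⊤≡⊥ → S≢⊥ (trans (sym (∩-identityʳ S)) S∩⊤≡⊥)) (∪-zeroʳ S))) ⟩
    hyperWienerWeight (distance S ⊥) + (hyperWienerWeight (distance S ⊤) + P) + 4 * 2 ^ ∣ ∁ S ∣ + 6 * 1 + 6 * 1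
      ≡⟨ cong₂ (λ a b → a + 4 * 2 ^ ∣ ∁ S ∣ + 6 * b + 6 * 1)
               (sym (∑-allSubsets (proper⇒⊥≢⊤ S-proper) (hyperWienerWeight ∘ distance S))) (sym (count-complement S)) ⟩
    ∑ L (hyperWienerWeight ∘ distance S) + 4 * 2 ^ ∣ ∁ S ∣ + 6 * ∑ L complement + 6 * 1
      ≡⟨ cong₂ (λ a b → ∑ L (hyperWienerWeight ∘ distance S) + 4 * a + 6 * ∑ L complement + 6 * b)
               (sym (count-disjoint S)) (sym (count-equal S)) ⟩
    ∑ L (hyperWienerWeight ∘ distance S) + 4 * ∑ L disjoint + 6 * ∑ L complement + 6 * ∑ L equal
      ≡⟨ sym (trans (∑-+-* 6 _ equal L) (cong (_+ 6 * ∑ L equal) (trans (∑-+-* 6 _ complement L)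
               (cong (_+ 6 * ∑ L complement) (∑-+-* 4 (hyperWienerWeight ∘ distance S) disjoint L))))) ⟩
    ∑[ U ∈ L ] (hyperWienerWeight (distance S U) + 4 * disjoint U + 6 * complement U + 6 * equal U)
      ≡⟨ ∑-cong L (λ {U} _ → hyperWienerWeight-identity S-proper U) ⟩
    ∑[ U ∈ L ] (6 + 6 * covering U)
      ≡⟨ ∑-+ (λ _ → 6) (λ U → 6 * covering U) L ⟩
    ∑[ U ∈ L ] (6 * 1) + ∑[ U ∈ L ] (6 * covering U)
      ≡⟨ cong₂ _+_ (∑-* 6 (λ _ → 1) L) (∑-* 6 covering L) ⟩
    6 * ∑[ U ∈ L ] 1 + 6 * ∑ L covering
      ≡⟨ cong₂ (λ a b → 6 * a + 6 * b) (count-all k) (count-covering S) ⟩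
    6 * 2 ^ k + 6 * 2 ^ ∣ S ∣                                     ∎
    where
    open ≡-Reasoning
    L : List (Subset k)
    L = allSubsets k
    P : ℕ
    P = ∑[ U ∈ properSubsets k ] hyperWienerWeight (distance S U)
    disjoint covering complement equal : Subset k → ℕ
    disjoint U   = 𝟙 (does (S ∩ U ≟ˢ ⊥))
    covering U   = 𝟙 (does (S ∪ U ≟ˢ ⊤))
    complement U = 𝟙 (does (S ∩ U ≟ˢ ⊥) ∧ does (S ∪ U ≟ˢ ⊤))
    equal U      = 𝟙 (does (S ≟ˢ U))
    rearrange : ∀ p x → p + (4 * x + 26) ≡ 2 + (12 + p) + 4 * x + 6 * 1 + 6 * 1
    rearrange = solve-∀

∑-upTo-suc : ∀ n (f : ℕ → ℕ) → ∑[ t ∈ upTo (suc n) ] f t ≡ f 0 + ∑[ t ∈ upTo n ] f (suc t)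
∑-upTo-suc n f = cong (λ ts → f 0 + sum ts) (trans (map-applyUpTo suc f n) (sym (map-applyUpTo (λ t → t) (f ∘ suc) n)))

-- The range of t may exceed k since k C t vanishes beyond k; this makes the induction uniform.
binomial : ∀ k {m} (h : ℕ → ℕ) → m > k → ∑[ S ∈ allSubsets k ] h ∣ S ∣ ≡ ∑[ t ∈ upTo m ] ((k C t) * h t)
binomial zero {suc m} h _ = sym (trans (∑-upTo-suc m (λ t → (0 C t) * h t)) (cong₂ _+_ (*-identityˡ (h 0)) (∑-zero (upTo m))))
binomial (suc k) {suc m} h (s≤s k<m) = begin
  ∑[ S ∈ allSubsets (suc k) ] h ∣ S ∣
    ≡⟨ ∑-allSubsets-suc k (h ∘ ∣_∣) ⟩
  ∑[ S ∈ allSubsets k ] h (suc ∣ S ∣) + ∑[ S ∈ allSubsets k ] h ∣ S ∣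
    ≡⟨ cong₂ _+_ (binomial k (h ∘ suc) k<m) (binomial k h (m≤n⇒m≤1+n k<m)) ⟩
  ∑[ t ∈ upTo m ] ((k C t) * h (suc t)) + ∑[ t ∈ upTo (suc m) ] ((k C t) * h t)
    ≡⟨ cong (∑[ t ∈ upTo m ] ((k C t) * h (suc t)) +_) (∑-upTo-suc m (λ t → (k C t) * h t)) ⟩
  a + (1 * h 0 + b)
    ≡⟨ rearrange a b (h 0) ⟩
  1 * h 0 + (a + b)
    ≡⟨ cong (1 * h 0 +_) (sym (∑-+ (λ t → (k C t) * h (suc t)) (λ t → (k C suc t) * h (suc t)) (upTo m))) ⟩
  1 * h 0 + ∑[ t ∈ upTo m ] ((k C t) * h (suc t) + (k C suc t) * h (suc t))
    ≡⟨ cong (1 * h 0 +_) (∑-cong (upTo m) λ {t} _ → pascal t) ⟩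
  1 * h 0 + ∑[ t ∈ upTo m ] ((suc k C suc t) * h (suc t))
    ≡⟨ ∑-upTo-suc m (λ t → (suc k C t) * h t) ⟨
  ∑[ t ∈ upTo (suc m) ] ((suc k C t) * h t) ∎
  where
  open ≡-Reasoning
  a b : ℕ
  a = ∑[ t ∈ upTo m ] ((k C t) * h (suc t))
  b = ∑[ t ∈ upTo m ] ((k C suc t) * h (suc t))
  rearrange : ∀ a b x → a + (1 * x + b) ≡ 1 * x + (a + b)
  rearrange = solve-∀
  pascal : ∀ t → (k C t) * h (suc t) + (k C suc t) * h (suc t) ≡ (suc k C suc t) * h (suc t)
  pascal t = trans (sym (*-distribʳ-+ (h (suc t)) (k C t) (k C suc t))) (cong (_* h (suc t)) (nCk+nC[k+1]≡[n+1]C[k+1] k t))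

∑-properSubsets : ∀ k (h : ℕ → ℕ) → ∑[ S ∈ properSubsets k ] h ∣ S ∣ ≡ ∑[ t ∈ drop 1 (upTo k) ] ((k C t) * h t)
∑-properSubsets zero    h = refl
∑-properSubsets (suc k) h = +-cancelˡ-≡ (h 0 + h (suc k)) P M (begin
  h 0 + h (suc k) + P
    ≡⟨ cong₂ (λ a b → a + b + P) (cong h (sym (∣⊥∣≡0 (suc k)))) (cong h (sym (∣⊤∣≡n (suc k)))) ⟩
  h ∣ ⊥ {suc k} ∣ + h ∣ ⊤ {suc k} ∣ + P
    ≡⟨ +-assoc (h ∣ ⊥ {suc k} ∣) (h ∣ ⊤ {suc k} ∣) P ⟩
  h ∣ ⊥ {suc k} ∣ + (h ∣ ⊤ {suc k} ∣ + P)
    ≡⟨ ∑-allSubsets {suc k} (λ ()) (h ∘ ∣_∣) ⟨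
  ∑[ S ∈ allSubsets (suc k) ] h ∣ S ∣
    ≡⟨ binomial (suc k) h ≤-refl ⟩
  ∑[ t ∈ upTo (suc (suc k)) ] term t
    ≡⟨ cong (λ ts → ∑ ts term) (applyUpTo-∷ʳ (λ t → t) (suc k)) ⟨
  ∑[ t ∈ upTo (suc k) ∷ʳ suc k ] term t
    ≡⟨ ∑-++ term (upTo (suc k)) (suc k ∷ []) ⟩
  (term 0 + M) + (term (suc k) + 0)
    ≡⟨ cong (λ c → (term 0 + M) + (c * h (suc k) + 0)) (nCn≡1 (suc k)) ⟩
  (1 * h 0 + M) + (1 * h (suc k) + 0)
    ≡⟨ rearrange (h 0) (h (suc k)) M ⟩
  h 0 + h (suc k) + M ∎)
  where
  open ≡-Reasoning
  term : ℕ → ℕ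
  term t = (suc k C t) * h t
  P M : ℕ
  P = ∑[ S ∈ properSubsets (suc k) ] h ∣ S ∣
  M = ∑[ t ∈ drop 1 (upTo (suc k)) ] term t
  rearrange : ∀ a b m → (1 * a + m) + (1 * b + 0) ≡ a + b + m
  rearrange = solve-∀

-- Ideals of ℤ_N for squarefree N

all-prime : ∀ {k} {p : Fin k → ℕ} → (∀ i → Prime (p i)) → All Prime (map p (allFin k))
all-prime {p = p} p-prime = All.tabulate λ q∈ps → let i , _ , q≡pi = ∈-map⁻ p q∈ps in subst Prime (sym q≡pi) (p-prime i)

module SquarefreeModulus {k} (p : Fin k → ℕ) (p-prime : ∀ i → Prime (p i)) (p-injective : ∀ {i j} → p i ≡ p j → i ≡ j)
                         {m} (∏p≡N : productℕ (map p (allFin k)) ≡ suc m) where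

  open Residues m public

  private
    primes : List ℕ
    primes = map p (allFin k)

    primes-prime : All Prime primes
    primes-prime = all-prime p-prime

    primes-unique : Unique primes
    primes-unique = Unique.map⁺ p-injective (Unique.allFin⁺ k)

    p∈primes : ∀ i → p i ∈ primes
    p∈primes i = ∈-map⁺ p (∈-allFin i)

  p∣N : ∀ i → p i ∣ N
  p∣N i = subst (p i ∣_) ∏p≡N (∈⇒∣product (p∈primes i))

  squarefree : ∀ {g x} → g ∣ N → (∀ i → p i ∣ g → p i ∣ x) → g ∣ x
  squarefree g∣N ∣x = squarefree-∣ primes-prime primes-unique (subst (_ ∣_) (sym ∏p≡N) g∣N)
    λ q∈primes q∣g → let i , _ , q≡pi = ∈-map⁻ p q∈primes in subst (_∣ _) (sym q≡pi) (∣x i (subst (_∣ _) q≡pi q∣g))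

  all-p∣⇒≡0 : ∀ (x : Fin N) → (∀ i → p i ∣ toℕ x) → toℕ x ≡ 0
  all-p∣⇒≡0 x all-p∣x = trans (sym (m<n⇒m%n≡m (toℕ<n x))) (n∣m⇒m%n≡0 (toℕ x) N (squarefree ∣-refl λ i _ → all-p∣x i))

  cofactor-of : ∀ i → ∃ λ c → ¬ p i ∣ c × (∀ j → j ≢ i → p j ∣ c)
  cofactor-of i with ∃-cofactor primes-prime primes-unique (p∈primes i)
  ... | c , pi∤c , pj∣c = c , pi∤c , λ j j≢i → pj∣c (p∈primes j) (j≢i ∘ p-injective)

  ∣-mod : ∀ {d x} → d ∣ N → d ∣ x → d ∣ toℕ (x mod N)
  ∣-mod {x = x} d∣N d∣x = subst (_ ∣_) (sym (toℕ-mod x)) (%-presˡ-∣ d∣x d∣N)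

  -- The ideal generated by the product of the p i with i ∈ S.
  idealOf : Subset k → SubsetZ N
  idealOf S = tabulate (λ x → ∀ₙ (λ i → (i ∈ᵇ S) ⇒ᵇ does (p i ∣? toℕ x)))

  ∈idealOf⇔ : ∀ S a → T (a ∈ᵇ idealOf S) ⇔ (∀ i → T (i ∈ᵇ S) → p i ∣ toℕ a)
  ∈idealOf⇔ S a = subst (λ b → T b ⇔ (∀ i → T (i ∈ᵇ S) → p i ∣ toℕ a))
                        (sym (lookup∘tabulate (λ x → ∀ₙ (λ i → (i ∈ᵇ S) ⇒ᵇ does (p i ∣? toℕ x))) a)) (mk⇔
    (λ a∈ i i∈S → to (T-does (p i ∣? toℕ a)) (to T-⇒ᵇ (to (T-∀ₙ {k}) a∈ i) i∈S))
    (λ ∣a → from (T-∀ₙ {k}) λ i → from T-⇒ᵇ (from (T-does (p i ∣? toℕ a)) ∘ ∣a i)))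

  ∈ᶻidealOf⇔ : ∀ S x → x ∈ᶻ idealOf S ⇔ (∀ i → T (i ∈ᵇ S) → p i ∣ x)
  ∈ᶻidealOf⇔ S x = mk⇔
    (λ x∈ i i∈S → ∣n∣m%n⇒∣m (p∣N i) (subst (_ ∣_) (toℕ-mod x) (to (∈idealOf⇔ S (x mod N)) (to ∈ᶻ⇔ x∈) i i∈S)))
    (λ ∣x → from ∈ᶻ⇔ (from (∈idealOf⇔ S (x mod N)) λ i i∈S → ∣-mod (p∣N i) (∣x i i∈S)))

  idealOf-IsIdeal : ∀ S → IsIdeal (idealOf S)
  idealOf-IsIdeal S = record
    { 0∈       = from (∈ᶻidealOf⇔ S 0) λ i _ → p i ∣0
    ; +-closed = λ x∈ y∈ → from (∈ᶻidealOf⇔ S _) λ i i∈S →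
                   ∣m∣n⇒∣m+n (to (∈ᶻidealOf⇔ S _) x∈ i i∈S) (to (∈ᶻidealOf⇔ S _) y∈ i i∈S)
    ; *-closed = λ r x∈ → from (∈ᶻidealOf⇔ S _) λ i i∈S → ∣n⇒∣m*n r (to (∈ᶻidealOf⇔ S _) x∈ i i∈S)
    }

  idealOf-isIdeal : ∀ S → T (isIdeal (idealOf S))
  idealOf-isIdeal S = isIdeal⁺ {I = idealOf S}
    (0 mod N , refl , from (∈idealOf⇔ S (0 mod N)) λ i _ → p i ∣0)
    (λ a b a∈ b∈ → from (∈idealOf⇔ S (addₙ a b)) λ i i∈S → ∣-mod (p∣N i) (∣m∣n⇒∣m+n (∣a a a∈ i i∈S) (∣a b b∈ i i∈S)))
    (λ a a∈ → from (∈idealOf⇔ S (negₙ a)) λ i i∈S → ∣-mod (p∣N i) (∣m∣n⇒∣m∸n (p∣N i) (∣a a a∈ i i∈S) (<⇒≤ (toℕ<n a))))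
    (λ r a a∈ → from (∈idealOf⇔ S (mulₙ r a)) λ i i∈S → ∣-mod (p∣N i) (∣n⇒∣m*n (toℕ r) (∣a a a∈ i i∈S)))
    where
    ∣a : ∀ a → T (a ∈ᵇ idealOf S) → ∀ i → T (i ∈ᵇ S) → p i ∣ toℕ a
    ∣a a = to (∈idealOf⇔ S a)

  primesOf : SubsetZ N → Subset k
  primesOf I = tabulate (λ i → does (p i ∣? generator I))

  ideal≡idealOf-primesOf : ∀ {I} → T (isIdeal I) → I ≡ idealOf (primesOf I)
  ideal≡idealOf-primesOf {I} isIdeal-I = ∈ᵇ-ext same-members
    where
    I-ideal : IsIdeal I
    I-ideal = isIdeal⇒IsIdeal isIdeal-I
    same-members : ∀ a → T (a ∈ᵇ I) ⇔ T (a ∈ᵇ idealOf (primesOf I))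
    same-members a = mk⇔
      (λ a∈I → from (∈idealOf⇔ (primesOf I) a) λ i i∈ →
         ∣-trans (to (T-does (p i ∣? generator I)) (subst T (lookup∘tabulate _ i) i∈)) (generator-∣ I a∈I))
      (λ a∈ → from (∈⇔generator-∣ I I-ideal a) (squarefree (generator-∣N I) λ i pi∣g →
         to (∈idealOf⇔ (primesOf I) a) a∈ i (subst T (sym (lookup∘tabulate _ i)) (from (T-does (p i ∣? generator I)) pi∣g))))

  cofactor : Fin k → ℕ
  cofactor i = proj₁ (cofactor-of i)

  module _ (i : Fin k) where

    private
      c : ℕ
      c = cofactor i
      pi∤c : ¬ p i ∣ c
      pi∤c = proj₁ (proj₂ (cofactor-of i))
      pj∣c : ∀ j → j ≢ i → p j ∣ c
      pj∣c = proj₂ (proj₂ (cofactor-of i))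

    cofactor∈ : ∀ S → ¬ T (i ∈ᵇ S) → c ∈ᶻ idealOf S
    cofactor∈ S i∉S = from (∈ᶻidealOf⇔ S c) λ j j∈S → pj∣c j λ { refl → i∉S j∈S }

    cofactor∉ : ∀ S → T (i ∈ᵇ S) → ¬ c ∈ᶻ idealOf S
    cofactor∉ S i∈S c∈ = pi∤c (to (∈ᶻidealOf⇔ S c) c∈ i i∈S)

    cofactor≢0 : toℕ (c mod N) ≢ 0
    cofactor≢0 c%N≡0 = pi∤c (∣-trans (p∣N i) (m%n≡0⇒n∣m c N (trans (sym (toℕ-mod c)) c%N≡0)))

    p∣generator⇒∈ : ∀ S → p i ∣ generator (idealOf S) → T (i ∈ᵇ S)
    p∣generator⇒∈ S pi∣g = decidable-stable (T? (i ∈ᵇ S)) λ i∉S →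
      pi∤c (∣n∣m%n⇒∣m (p∣N i) (subst (_ ∣_) (toℕ-mod c) (∣-trans pi∣g (generator-∣ (idealOf S) (to ∈ᶻ⇔ (cofactor∈ S i∉S))))))

  idealOf-⊆⁻ : ∀ S U → (∀ x → x ∈ᶻ idealOf S → x ∈ᶻ idealOf U) → ∀ i → T (i ∈ᵇ U) → T (i ∈ᵇ S)
  idealOf-⊆⁻ S U S⊆U i i∈U = decidable-stable (T? (i ∈ᵇ S)) λ i∉S → cofactor∉ i U i∈U (S⊆U _ (cofactor∈ i S i∉S))

  idealOf-injective : ∀ {S U} → idealOf S ≡ idealOf U → S ≡ U
  idealOf-injective {S} {U} eq = ∈ᵇ-ext λ i →
    mk⇔ (idealOf-⊆⁻ U S (λ x → subst (x ∈ᶻ_) (sym eq)) i) (idealOf-⊆⁻ S U (λ x → subst (x ∈ᶻ_) eq) i)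

  isNonzero-idealOf : ∀ S → T (isNonzero (idealOf S)) ⇔ S ≢ ⊤
  isNonzero-idealOf S = mk⇔
    (λ nonzero S≡⊤ → let x , x≢0 , x∈ = to (T-isNonzero {I = idealOf S}) nonzero in
       x≢0 (all-p∣⇒≡0 x λ i → to (∈idealOf⇔ S x) x∈ i (subst (λ X → T (i ∈ᵇ X)) (sym S≡⊤) (∈⊤ i))))
    (λ S≢⊤ → let i , i∉S = ≢⊤⇒∉ S≢⊤ in
       from (T-isNonzero {I = idealOf S}) (cofactor i mod N , cofactor≢0 i , to ∈ᶻ⇔ (cofactor∈ i S i∉S)))

  isProper-idealOf : ∀ S → T (isProper (idealOf S)) ⇔ S ≢ ⊥
  isProper-idealOf S = mk⇔
    (λ proper S≡⊥ → let x , x∉ = to (T-isProper {I = idealOf S}) proper in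
       x∉ (from (∈idealOf⇔ S x) λ i i∈S → ⊥-elim (∉⊥ i (subst (λ X → T (i ∈ᵇ X)) S≡⊥ i∈S))))
    (λ S≢⊥ → let i , i∈S = ≢⊥⇒∈ S≢⊥ in
       from (T-isProper {I = idealOf S}) (1 mod N , λ 1∈ →
         prime≢1 (p-prime i) (∣1⇒≡1 (to (∈ᶻidealOf⇔ S 1) (from ∈ᶻ⇔ 1∈) i i∈S))))

  private
    ∈ideals : ∀ S → idealOf S ∈ ideals N
    ∈ideals S = ∈-filter⁺ (T? ∘ isIdeal) (∈-allSubsets (idealOf S)) (idealOf-isIdeal S)

    ∣+ᴵ : ∀ {S U i x} → T (i ∈ᵇ S) → T (i ∈ᵇ U) → T (x ∈ᵇ (idealOf S +ᴵ idealOf U)) → p i ∣ toℕ x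
    ∣+ᴵ {S} {U} {i} {x} i∈S i∈U x∈ = ∣sum (to (T-+ᴵ {I = idealOf S} {idealOf U} x) x∈)
      where
      ∣sum : (∃ λ a → ∃ λ b → T (a ∈ᵇ idealOf S) × T (b ∈ᵇ idealOf U) × toℕ (addₙ a b) ≡ toℕ x) → p i ∣ toℕ x
      ∣sum (a , b , a∈ , b∈ , a+b≡x) = subst (p i ∣_) a+b≡x (∣-mod (p∣N i)
        (∣m∣n⇒∣m+n (to (∈idealOf⇔ S a) a∈ i i∈S) (to (∈idealOf⇔ U b) b∈ i i∈U)))

  -- idealOf (∁ (S ∩ U)) is nonzero, but every p i divides each of its elements that lies in the sum.
  intersecting⇒inessential : ∀ {S U} → S ∩ U ≢ ⊥ → ¬ T (isEssential (idealOf S +ᴵ idealOf U))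
  intersecting⇒inessential {S} {U} S∩U≢⊥ essential = z≢0 (all-p∣⇒≡0 z all-p∣z)
    where
    S+U J : SubsetZ N
    S+U = idealOf S +ᴵ idealOf U
    J   = idealOf (∁ (S ∩ U))
    meets : T (isNonzero (S+U ∩ᴵ J))
    meets = to (T-isEssential {I = S+U}) essential (∈ideals (∁ (S ∩ U)))
              (from (isNonzero-idealOf (∁ (S ∩ U))) (S∩U≢⊥ ∘ ∁≡⊤⇒≡⊥))
    common : ∃ λ z → toℕ z ≢ 0 × T (z ∈ᵇ (S+U ∩ᴵ J))
    common = to (T-isNonzero {I = S+U ∩ᴵ J}) meets
    z : Fin N
    z = proj₁ common
    z≢0 : toℕ z ≢ 0
    z≢0 = proj₁ (proj₂ common)
    z∈S+U×z∈J : T (z ∈ᵇ S+U) × T (z ∈ᵇ J)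
    z∈S+U×z∈J = to (T-∩ᴵ {I = S+U} {J} z) (proj₂ (proj₂ common))
    all-p∣z : ∀ i → p i ∣ toℕ z
    all-p∣z i = by-membership (T? (i ∈ᵇ (S ∩ U)))
      where
      by-membership : Dec (T (i ∈ᵇ (S ∩ U))) → p i ∣ toℕ z
      by-membership (yes i∈S∩U) = let i∈S , i∈U = to (T-∩ᴵ {I = S} {U} i) i∈S∩U in
        ∣+ᴵ {S} {U} i∈S i∈U (proj₁ z∈S+U×z∈J)
      by-membership (no i∉S∩U)  = to (∈idealOf⇔ (∁ (S ∩ U)) z) (proj₂ z∈S+U×z∈J) i (from (∈∁⇔ {S = S ∩ U} i) i∉S∩U)

  private
    -- m v ≡ - v modulo N = m + 1.
    bezout-unit : ∀ {u v} → 1 + v ≡ u → (u + m * v) % N ≡ 1 % N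
    bezout-unit {u} {v} 1+v≡u = begin
      (u + m * v) % N           ≡⟨ cong (λ z → (z + m * v) % N) (sym 1+v≡u) ⟩
      (1 + v + m * v) % N       ≡⟨ cong (_% N) (+-assoc 1 v (m * v)) ⟩
      (1 + (v + m * v)) % N     ≡⟨ cong (λ z → (1 + z) % N) (*-comm (suc m) v) ⟩
      (1 + v * N) % N           ≡⟨ [m+kn]%n≡m%n 1 v N ⟩
      1 % N                     ∎
      where open ≡-Reasoning

  disjoint⇒+ᴵ-full : ∀ {S U} → S ∩ U ≡ ⊥ → ∀ x → T (x ∈ᵇ (idealOf S +ᴵ idealOf U))
  disjoint⇒+ᴵ-full {S} {U} S∩U≡⊥ = from-Bézout (coprime-Bézout coprime)
    where
    gS gU : ℕ
    gS = generator (idealOf S)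
    gU = generator (idealOf U)
    gS∈ : gS ∈ᶻ idealOf S
    gS∈ = generator-∈ (idealOf S) (idealOf-IsIdeal S)
    gU∈ : gU ∈ᶻ idealOf U
    gU∈ = generator-∈ (idealOf U) (idealOf-IsIdeal U)
    not-both : ∀ i → T (i ∈ᵇ S) → ¬ T (i ∈ᵇ U)
    not-both i i∈S i∈U = ∉⊥ i (subst (λ X → T (i ∈ᵇ X)) S∩U≡⊥ (from (T-∩ᴵ {I = S} {U} i) (i∈S , i∈U)))
    coprime : Coprime gS gU
    coprime (d∣gS , d∣gU) = ∣1⇒≡1 (squarefree (∣-trans d∣gS (generator-∣N (idealOf S))) λ i pi∣d →
      ⊥-elim (not-both i (p∣generator⇒∈ i S (∣-trans pi∣d d∣gS)) (p∣generator⇒∈ i U (∣-trans pi∣d d∣gU))))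
    open IsIdeal
    from-Bézout : Bézout.Identity 1 gS gU → ∀ x → T (x ∈ᵇ (idealOf S +ᴵ idealOf U))
    from-Bézout (Bézout.+- a b 1+bgU≡agS) =
      +ᴵ-full (idealOf-IsIdeal S) (idealOf-IsIdeal U) (*-closed (idealOf-IsIdeal S) a gS∈)
              (*-closed (idealOf-IsIdeal U) m (*-closed (idealOf-IsIdeal U) b gU∈)) (bezout-unit 1+bgU≡agS)
    from-Bézout (Bézout.-+ a b 1+agS≡bgU) =
      +ᴵ-full (idealOf-IsIdeal S) (idealOf-IsIdeal U) (*-closed (idealOf-IsIdeal S) m (*-closed (idealOf-IsIdeal S) a gS∈))
              (*-closed (idealOf-IsIdeal U) b gU∈) (trans (cong (_% N) (+-comm (m * (a * gS)) (b * gU))) (bezout-unit 1+agS≡bgU))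

  essential⇔disjoint : ∀ S U → T (isEssential (idealOf S +ᴵ idealOf U)) ⇔ S ∩ U ≡ ⊥
  essential⇔disjoint S U = mk⇔
    (λ essential → decidable-stable (S ∩ U ≟ˢ ⊥) λ S∩U≢⊥ → intersecting⇒inessential S∩U≢⊥ essential)
    (λ S∩U≡⊥ → full⇒essential {I = idealOf S +ᴵ idealOf U} (disjoint⇒+ᴵ-full S∩U≡⊥))

  open FinGraph (essentialIdealGraph N) using (V; adj; _≟ᵥ_)

  idealOf≟⇔ : ∀ S U → T (idealOf S ≟ᵥ idealOf U) ⇔ S ≡ U
  idealOf≟⇔ S U = mk⇔ (idealOf-injective ∘ to (T-==ˢ {I = idealOf S})) (from (T-==ˢ {I = idealOf S}) ∘ cong idealOf)

  adjacent⇔disjoint : ∀ {S} U → S ≢ ⊥ → T (adj (idealOf S) (idealOf U)) ⇔ S ∩ U ≡ ⊥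
  adjacent⇔disjoint {S} U S≢⊥ = mk⇔
    (to (essential⇔disjoint S U) ∘ proj₂ ∘ to (T-∧ {not (idealOf S ==ˢ idealOf U)}))
    (λ S∩U≡⊥ → from (T-∧ {not (idealOf S ==ˢ idealOf U)})
      ( from T-not (λ S==U → S≢⊥ (S≡⊥ S∩U≡⊥ (to (idealOf≟⇔ S U) S==U)))
      , from (essential⇔disjoint S U) S∩U≡⊥))
    where
    S≡⊥ : S ∩ U ≡ ⊥ → S ≡ U → S ≡ ⊥
    S≡⊥ S∩U≡⊥ refl = trans (sym (∩-idem S)) S∩U≡⊥

  vertices↭ : V ↭ map idealOf (properSubsets k)
  vertices↭ = unique-⇔⇒↭ (Unique.filter⁺ (T? ∘ isVertex) (allSubsets-unique N))
                         (Unique.map⁺ idealOf-injective (properSubsets-unique k))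
                         (mk⇔ vertex⇒ ⇒vertex)
    where
    isVertex : SubsetZ N → Bool
    isVertex I = isIdeal I ∧ isNonzero I ∧ isProper I
    vertex⇒ : ∀ {I} → I ∈ V → I ∈ map idealOf (properSubsets k)
    vertex⇒ {I} I∈V = subst (_∈ map idealOf (properSubsets k)) (sym I≡) (∈-map⁺ idealOf (from ∈-properSubsets
        ( to (isProper-idealOf (primesOf I)) (subst (T ∘ isProper) I≡ proper)
        , to (isNonzero-idealOf (primesOf I)) (subst (T ∘ isNonzero) I≡ nonzero))))
      where
      isVertex-I : T (isVertex I)
      isVertex-I = proj₂ (∈-filter⁻ (T? ∘ isVertex) {xs = allSubsets N} I∈V)
      ideal : T (isIdeal I)
      ideal = proj₁ (to (T-∧ {isIdeal I}) isVertex-I)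
      nonzero : T (isNonzero I)
      nonzero = proj₁ (to (T-∧ {isNonzero I}) (proj₂ (to (T-∧ {isIdeal I}) isVertex-I)))
      proper : T (isProper I)
      proper = proj₂ (to (T-∧ {isNonzero I}) (proj₂ (to (T-∧ {isIdeal I}) isVertex-I)))
      I≡ : I ≡ idealOf (primesOf I)
      I≡ = ideal≡idealOf-primesOf ideal
    ⇒vertex : ∀ {I} → I ∈ map idealOf (properSubsets k) → I ∈ V
    ⇒vertex I∈ with ∈-map⁻ idealOf I∈
    ... | S , S∈ , refl = ∈-filter⁺ (T? ∘ isVertex) (∈-allSubsets (idealOf S))
          (from (T-∧ {isIdeal (idealOf S)}) (idealOf-isIdeal S , from (T-∧ {isNonzero (idealOf S)})
            ( from (isNonzero-idealOf S) (proj₂ S-proper)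
            , from (isProper-idealOf S) (proj₁ S-proper))))
      where
      S-proper : Proper S
      S-proper = to ∈-properSubsets S∈

-- The hyper-Wiener index

module FormulaArithmetic where

  open import Data.Integer as ℤ using (ℤ; +_)
  import Data.Integer.Properties as ℤ
  import Data.Integer.Tactic.RingSolver as ℤ

  -- The summand of wwFormula, which Defs keeps local; wwFormula k unfolds to
  -- sumℤ (map (formulaTerm k) (drop 1 (upTo k))) / 2.
  formulaTerm : ℕ → ℕ → ℤ
  formulaTerm k t = (+ (k C t)) ℤ.* ((((+ (3 * 2 ^ k)) ℤ.- (+ (2 * 2 ^ (k ∸ t)))) ℤ.+ (+ (3 * 2 ^ t))) ℤ.- (+ 13))

  -- ∑ over the proper subsets U of hyperWienerWeight (distance S U) is vertexSum⁺ k ∣ S ∣ - vertexSum⁻ k ∣ S ∣.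
  vertexSum⁺ vertexSum⁻ : ℕ → ℕ → ℕ
  vertexSum⁺ k t = 6 * 2 ^ k + 6 * 2 ^ t
  vertexSum⁻ k t = 4 * 2 ^ (k ∸ t) + 26

  doubled-formulaTerm : ∀ k t → + 2 ℤ.* formulaTerm k t ≡ + ((k C t) * vertexSum⁺ k t) ℤ.- + ((k C t) * vertexSum⁻ k t)
  doubled-formulaTerm k t = begin
    + 2 ℤ.* (+ c ℤ.* (((+ (3 * a) ℤ.- + (2 * b)) ℤ.+ + (3 * d)) ℤ.- + 13))
      ≡⟨ cong (λ z → + 2 ℤ.* (+ c ℤ.* (z ℤ.- + 13)))
              (cong₂ ℤ._+_ (cong₂ ℤ._-_ (ℤ.pos-* 3 a) (ℤ.pos-* 2 b)) (ℤ.pos-* 3 d)) ⟩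
    + 2 ℤ.* (+ c ℤ.* (((+ 3 ℤ.* + a ℤ.- + 2 ℤ.* + b) ℤ.+ + 3 ℤ.* + d) ℤ.- + 13))
      ≡⟨ polynomial (+ c) (+ a) (+ b) (+ d) ⟩
    + c ℤ.* (+ 6 ℤ.* + a ℤ.+ + 6 ℤ.* + d) ℤ.- + c ℤ.* (+ 4 ℤ.* + b ℤ.+ + 26)
      ≡⟨ cong₂ ℤ._-_
           (trans (ℤ.pos-* c (6 * a + 6 * d))
                  (cong (+ c ℤ.*_) (trans (ℤ.pos-+ (6 * a) (6 * d)) (cong₂ ℤ._+_ (ℤ.pos-* 6 a) (ℤ.pos-* 6 d)))))
           (trans (ℤ.pos-* c (4 * b + 26)) (cong (+ c ℤ.*_) (trans (ℤ.pos-+ (4 * b) 26) (cong (ℤ._+ + 26) (ℤ.pos-* 4 b))))) ⟨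
    + (c * (6 * a + 6 * d)) ℤ.- + (c * (4 * b + 26)) ∎
    where
    open ≡-Reasoning
    c a b d : ℕ
    c = k C t
    a = 2 ^ k
    b = 2 ^ (k ∸ t)
    d = 2 ^ t
    polynomial : ∀ c a b d → + 2 ℤ.* (c ℤ.* (((+ 3 ℤ.* a ℤ.- + 2 ℤ.* b) ℤ.+ + 3 ℤ.* d) ℤ.- + 13))
                           ≡ c ℤ.* (+ 6 ℤ.* a ℤ.+ + 6 ℤ.* d) ℤ.- c ℤ.* (+ 4 ℤ.* b ℤ.+ + 26)
    polynomial = ℤ.solve-∀

  doubled-sum : ∀ k ts → + 2 ℤ.* sumℤ (map (formulaTerm k) ts)
                       ≡ + ∑[ t ∈ ts ] ((k C t) * vertexSum⁺ k t) ℤ.- + ∑[ t ∈ ts ] ((k C t) * vertexSum⁻ k t)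
  doubled-sum k []       = refl
  doubled-sum k (t ∷ ts) = begin
    + 2 ℤ.* (formulaTerm k t ℤ.+ sumℤ (map (formulaTerm k) ts))
      ≡⟨ ℤ.*-distribˡ-+ (+ 2) (formulaTerm k t) _ ⟩
    + 2 ℤ.* formulaTerm k t ℤ.+ + 2 ℤ.* sumℤ (map (formulaTerm k) ts)
      ≡⟨ cong₂ ℤ._+_ (doubled-formulaTerm k t) (doubled-sum k ts) ⟩
    (+ term⁺ t ℤ.- + term⁻ t) ℤ.+ (+ ∑ ts term⁺ ℤ.- + ∑ ts term⁻)
      ≡⟨ rearrange (+ term⁺ t) (+ term⁻ t) (+ ∑ ts term⁺) (+ ∑ ts term⁻) ⟩
    (+ term⁺ t ℤ.+ + ∑ ts term⁺) ℤ.- (+ term⁻ t ℤ.+ + ∑ ts term⁻)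
      ≡⟨ cong₂ ℤ._-_ (ℤ.pos-+ (term⁺ t) (∑ ts term⁺)) (ℤ.pos-+ (term⁻ t) (∑ ts term⁻)) ⟨
    + (term⁺ t + ∑ ts term⁺) ℤ.- + (term⁻ t + ∑ ts term⁻) ∎
    where
    open ≡-Reasoning
    term⁺ term⁻ : ℕ → ℕ
    term⁺ t = (k C t) * vertexSum⁺ k t
    term⁻ t = (k C t) * vertexSum⁻ k t
    rearrange : ∀ a b c d → (a ℤ.- b) ℤ.+ (c ℤ.- d) ≡ (a ℤ.+ c) ℤ.- (b ℤ.+ d)
    rearrange = ℤ.solve-∀

  sumℤ-formulaTerm : ∀ k X ts →
                     2 * X + ∑[ t ∈ ts ] ((k C t) * vertexSum⁻ k t) ≡ ∑[ t ∈ ts ] ((k C t) * vertexSum⁺ k t) →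
                     + X ≡ sumℤ (map (formulaTerm k) ts)
  sumℤ-formulaTerm k X ts 2X+∑term⁻≡∑term⁺ = ℤ.*-cancelˡ-≡ (+ 2) (+ X) _ (begin
    + 2 ℤ.* + X                                    ≡⟨ ℤ.pos-* 2 X ⟨
    + (2 * X)                                      ≡⟨ add-sub (+ (2 * X)) (+ ∑ ts term⁻) ⟩
    (+ (2 * X) ℤ.+ + ∑ ts term⁻) ℤ.- + ∑ ts term⁻  ≡⟨ cong (ℤ._- + ∑ ts term⁻)
                                                         (trans (sym (ℤ.pos-+ (2 * X) (∑ ts term⁻))) (cong +_ 2X+∑term⁻≡∑term⁺)) ⟩
    + ∑ ts term⁺ ℤ.- + ∑ ts term⁻                  ≡⟨ doubled-sum k ts ⟨
    + 2 ℤ.* sumℤ (map (formulaTerm k) ts)          ∎)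
    where
    open ≡-Reasoning
    term⁺ term⁻ : ℕ → ℕ
    term⁺ t = (k C t) * vertexSum⁺ k t
    term⁻ t = (k C t) * vertexSum⁻ k t
    add-sub : ∀ x y → x ≡ (x ℤ.+ y) ℤ.- y
    add-sub = ℤ.solve-∀

open FormulaArithmetic

module EssentialIdealGraphOfSquarefree {k} (p : Fin k → ℕ) (p-prime : ∀ i → Prime (p i)) (p-injective : ∀ {i j} → p i ≡ p j → i ≡ j)
                                      {m} (∏p≡N : productℕ (map p (allFin k)) ≡ suc m) where

  open SquarefreeModulus p p-prime p-injective ∏p≡N

  open FinGraph (essentialIdealGraph N) using (adj; _≟ᵥ_)

  ≟ᵥ⇔distance≡0 : ∀ {S U} → S ∈ properSubsets k → U ∈ properSubsets k →
                  T (idealOf S ≟ᵥ idealOf U) ⇔ distance S U ≡ 0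
  ≟ᵥ⇔distance≡0 {S} {U} _ _ = ⇔.trans (idealOf≟⇔ S U) (⇔.sym distance≡0⇔≡)

  adjacent⇒distance-step : ∀ {S W U} → S ∈ properSubsets k → W ∈ properSubsets k → U ∈ properSubsets k →
                           T (adj (idealOf W) (idealOf U)) → distance S U ≤ suc (distance S W)
  adjacent⇒distance-step {S} {W} {U} _ W∈ _ adj-WU = distance-step S W≢⊥ (to (adjacent⇔disjoint U W≢⊥) adj-WU)
    where
    W≢⊥ : W ≢ ⊥
    W≢⊥ = proj₁ (to ∈-properSubsets W∈)

  adjacent-predecessor : ∀ {S U d} → S ∈ properSubsets k → U ∈ properSubsets k → distance S U ≡ suc d →
                         ∃ λ W → W ∈ properSubsets k × distance S W ≡ d × T (adj (idealOf W) (idealOf U))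
  adjacent-predecessor {U = U} S∈ U∈ δ≡1+d with distance-pred (to ∈-properSubsets S∈) (to ∈-properSubsets U∈) δ≡1+d
  ... | W , W-proper , δSW≡d , W∩U≡⊥ =
    W , from ∈-properSubsets W-proper , δSW≡d , from (adjacent⇔disjoint U (proj₁ W-proper)) W∩U≡⊥

  private
    module Layers = Layering (essentialIdealGraph N) (properSubsets k) idealOf vertices↭ distance
                             ≟ᵥ⇔distance≡0 adjacent⇒distance-step adjacent-predecessor

  open Layers public using (connected)

  hyperWiener≡wwFormula : hyperWiener (essentialIdealGraph N) ≡ wwFormula k
  hyperWiener≡wwFormula = cong (_/ 2) (sumℤ-formulaTerm k X (drop 1 (upTo k)) ( begin
    2 * X + ∑[ t ∈ drop 1 (upTo k) ] ((k C t) * vertexSum⁻ k t)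
      ≡⟨ cong₂ _+_ (Layers.doubled-hyperWiener distance-sym (λ S → from (distance≡0⇔≡ {S = S}) refl))
                   (sym (∑-properSubsets k (vertexSum⁻ k))) ⟩
    ∑[ S ∈ P ] ∑[ U ∈ P ] hyperWienerWeight (distance S U) + ∑[ S ∈ P ] vertexSum⁻ k ∣ S ∣
      ≡⟨ ∑-+ (λ S → ∑[ U ∈ P ] hyperWienerWeight (distance S U)) (λ S → vertexSum⁻ k ∣ S ∣) P ⟨
    ∑[ S ∈ P ] (∑[ U ∈ P ] hyperWienerWeight (distance S U) + vertexSum⁻ k ∣ S ∣)
      ≡⟨ ∑-cong P (λ {S} S∈ → trans (cong (λ c → ∑[ U ∈ P ] hyperWienerWeight (distance S U) + (4 * 2 ^ c + 26))
                                          (sym (∣∁p∣≡n∸∣p∣ S)))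
                                    (∑-hyperWienerWeight (to ∈-properSubsets S∈))) ⟩
    ∑[ S ∈ P ] vertexSum⁺ k ∣ S ∣
      ≡⟨ ∑-properSubsets k (vertexSum⁺ k) ⟩
    ∑[ t ∈ drop 1 (upTo k) ] ((k C t) * vertexSum⁺ k t) ∎))
    where
    open ≡-Reasoning
    G : FinGraph
    G = essentialIdealGraph N
    P : List (Subset k)
    P = properSubsets k
    X : ℕ
    X = wiener G + pairSum G (λ u v → dist G u v * dist G u v)

increasing⇒injective : ∀ {k} {p : Fin k → ℕ} → (∀ i j → i < j → p i Data.Nat.< p j) → ∀ {i j} → p i ≡ p j → i ≡ j
increasing⇒injective p-increasing {i} {j} pi≡pj with <-cmp i j
... | tri< i<j _ _ = ⊥-elim (<-irrefl pi≡pj (p-increasing i j i<j))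
... | tri≈ _ i≡j _ = i≡j
... | tri> _ _ j<i = ⊥-elim (<-irrefl (sym pi≡pj) (p-increasing j i j<i))

mainTheorem17 : (k : ℕ) (p : Fin k → ℕ) → (∀ i → Prime (p i)) → (∀ i j → i < j → p i Data.Nat.< p j) → (n : ℕ) → n ≡ productℕ (map p (allFin k))
    → Connected (essentialIdealGraph n) × hyperWiener (essentialIdealGraph n) ≡ wwFormula k
mainTheorem17 k p p-prime p-increasing n n≡∏p =
  subst (λ n → Connected (essentialIdealGraph n) × hyperWiener (essentialIdealGraph n) ≡ wwFormula k)
        (sym (trans n≡∏p ∏p≡N)) (connected , hyperWiener≡wwFormula)
  where
  instance _ = productOfPrimes≢0 (all-prime p-prime)
  ∏p≡N : productℕ (map p (allFin k)) ≡ suc (pred (productℕ (map p (allFin k))))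
  ∏p≡N = sym (suc-pred _)
  open EssentialIdealGraphOfSquarefree p p-prime (increasing⇒injective p-increasing) ∏p≡N
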